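{- Let $Z\in\mathsf{Pred}$, $k\in\mathbb{Z}$, $z\in\mathsf{Set}_k$. Let $i,j\in\mathbb{Z}$, $a\in\mathbb{A}_i$, $x\in\mathsf{Set}_i$, $b\in\mathbb{A}_j$, $y\in\mathsf{Set}_j$, with $a,b$ distinct, $a\#y$ and $b\#x$. Then $Z[a\mapsto x][b\mapsto y]=Z[b\mapsto y][a\mapsto x]$ and $z[a\mapsto x][b\mapsto y]=z[b\mapsto y][a\mapsto x]$.
   Context: Atoms: for each $i\in\mathbb{Z}$ fix a countably infinite set $\mathbb{A}_i$ of atoms, pairwise disjoint, $\mathbb{A}=\bigcup_i\mathbb{A}_i$, $\mathrm{level}(a)=i$ iff $a\in\mathbb{A}_i$. Permutations are finitely-supported level-preserving bijections of $\mathbb{A}$; $\mathrm{supp}(x)$ is the least finite set of atoms such that every permutation fixing it pointwise fixes $x$, and $a\#x$ means $a\notin\mathrm{supp}(x)$. $[a]X$ is nominal atoms-abstraction (binding $a$ in $X$): $[a]X=[b]((b\ a)\cdot X)$ when $b\#X$. Internal syntax: $\mathsf{Pred}$ and $\mathsf{Set}_i$ ($i\in\mathbb{Z}$) are defined inductively: $\mathsf{atm}(a)\in\mathsf{Set}_i$ for $a\in\mathbb{A}_i$; $\mathsf{and}(\mathcal X)\in\mathsf{Pred}$ for finite $\mathcal X\subseteq\mathsf{Pred}$; $\mathsf{neg}(X)$; $\mathsf{all}([a]X)$ for $a\in\mathbb{A}$; $\mathsf{elt}(x,a)\in\mathsf{Pred}$ for $a\in\mathbb{A}_{i+1}$, $x\in\mathsf{Set}_i$;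 $\mathsf{st}([a]X)\in\mathsf{Set}_i$ for $a\in\mathbb{A}_{i-1}$, $X\in\mathsf{Pred}$. Sigma-action: for $a\in\mathbb{A}_i$, $x\in\mathsf{Set}_i$, the well-defined operation $Z[a\mapsto x]$, $z[a\mapsto x]$ is given by (with $b,c$ atoms distinct from $a$): $\mathsf{and}(\mathcal X)[a\mapsto x]=\mathsf{and}(\{X[a\mapsto x]\mid X\in\mathcal X\})$; $\mathsf{neg}(X)[a\mapsto x]=\mathsf{neg}(X[a\mapsto x])$; $\mathsf{all}([b]X)[a\mapsto x]=\mathsf{all}([b](X[a\mapsto x]))$ if $b\#x$; $\mathsf{elt}(y,a)[a\mapsto\mathsf{atm}(n)]=\mathsf{elt}(y[a\mapsto\mathsf{atm}(n)],n)$ for any $n\in\mathbb{A}_i$; $\mathsf{elt}(y,a)[a\mapsto\mathsf{st}([a']X')]=X'[a'\mapsto y[a\mapsto\mathsf{st}([a']X')]]$ for fresh $a'\in\mathbb{A}_{i-1}$; $\mathsf{elt}(y,b)[a\mapsto x]=\mathsf{elt}(y[a\mapsto x],b)$; $\mathsf{atm}(a)[a\mapsto x]=x$; $\mathsf{atm}(b)[a\mapsto x]=\mathsf{atm}(b)$; $\mathsf{st}([c]X)[a\mapsto x]=\mathsf{st}([c](X[a\mapsto x]))$ if $c\#x$. -}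

module Defs where

open import Data.Nat as ℕ using (ℕ; zero; suc; _⊔_)
open import Data.Integer as ℤ using (ℤ; _-_; ∣_∣)
open import Data.List using (List; []; _∷_; _++_; map; foldr)
open import Data.Nat.ListAction using (sum)
open import Data.List.Membership.Propositional using (_∈_; _∉_)
open import Data.List.Relation.Unary.Any using (here; there)
open import Data.Sum using (_⊎_; inj₁; inj₂)
open import Data.Product using (Σ; _,_)
open import Relation.Nullary using (yes; no; ¬_)
open import Relation.Binary.PropositionalEquality using (_≡_; refl)

-- Atoms.  An atom of level i is a natural-number name tagged with i;
-- thus each 𝔸_i = Atom i is countably infinite and the 𝔸_i are disjoint
-- (an atom of 𝔸 is a pair (i , a) : Σ ℤ Atom).

record Atom (i : ℤ) : Set where
  constructor at
  field name : ℕ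
open Atom public

Distinct : ∀ {i j} → Atom i → Atom j → Set
Distinct {i} {j} a b = ¬ (_≡_ {A = Σ ℤ Atom} (i , a) (j , b))

-- Internal syntax, up to α-equivalence, in locally-nameless form:
-- free atoms are named, bound atoms are de Bruijn variables whose level
-- is tracked in the context Γ (list of levels of enclosing binders).
-- Pred [] and SetT [] i are exactly 𝖯𝗋𝖾𝖽 and 𝖲𝖾𝗍_i (α-equivalence
-- classes are represented canonically, so ≡ is equality of terms).
-- Reparametrisation: elt takes the atom level i and a set of level
-- pred i (paper: a ∈ 𝔸_{i+1}, x ∈ Set_i); st at level i binds level pred i.
-- Finite sets of predicates in 'and' are represented by lists.

data Pred (Γ : List ℤ) : Set
data SetT (Γ : List ℤ) : ℤ → Set

data Pred Γ where
  and  : List (Pred Γ) → Pred Γ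
  neg  : Pred Γ → Pred Γ
  all  : (l : ℤ) → Pred (l ∷ Γ) → Pred Γ
  elt  : ∀ {i} → SetT Γ (ℤ.pred i) → Atom i → Pred Γ
  eltB : ∀ {i} → SetT Γ (ℤ.pred i) → i ∈ Γ → Pred Γ

data SetT Γ where
  atm  : ∀ {i} → Atom i → SetT Γ i
  atmB : ∀ {i} → i ∈ Γ → SetT Γ i
  st   : ∀ {i} → Pred (ℤ.pred i ∷ Γ) → SetT Γ i

mutual
  atomsP : ∀ {Γ} → ℤ → Pred Γ → List ℕ
  atomsP l (and Xs) = atomsL l Xs
  atomsP l (neg X) = atomsP l X
  atomsP l (all _ X) = atomsP l X
  atomsP l (elt {i} y c) with i ℤ.≟ l
  ... | yes _ = name c ∷ atomsT l y
  ... | no _ = atomsT l y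
  atomsP l (eltB y _) = atomsT l y

  atomsL : ∀ {Γ} → ℤ → List (Pred Γ) → List ℕ
  atomsL l [] = []
  atomsL l (X ∷ Xs) = atomsP l X ++ atomsL l Xs

  atomsT : ∀ {Γ k} → ℤ → SetT Γ k → List ℕ
  atomsT {k = k} l (atm c) with k ℤ.≟ l
  ... | yes _ = name c ∷ []
  ... | no _ = []
  atomsT l (atmB _) = []
  atomsT l (st X) = atomsP l X

_#_ : ∀ {i Γ k} → Atom i → SetT Γ k → Set
_#_ {i} a y = name a ∉ atomsT i y

-- Levels of atoms bound by 'st' (used only to compute enough fuel)

mutual
  stP : ∀ {Γ} → Pred Γ → List ℤ
  stP (and Xs) = stL Xs
  stP (neg X) = stP X
  stP (all _ X) = stP X
  stP (elt y _) = stT y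
  stP (eltB y _) = stT y

  stL : ∀ {Γ} → List (Pred Γ) → List ℤ
  stL [] = []
  stL (X ∷ Xs) = stP X ++ stL Xs

  stT : ∀ {Γ k} → SetT Γ k → List ℤ
  stT (atm _) = []
  stT (atmB _) = []
  stT {k = k} (st X) = ℤ.pred k ∷ stP X

Ren : List ℤ → List ℤ → Set
Ren Γ Δ = ∀ {l} → l ∈ Γ → Atom l ⊎ l ∈ Δ

lift : ∀ {Γ Δ k} → Ren Γ Δ → Ren (k ∷ Γ) (k ∷ Δ)
lift ρ (here p) = inj₂ (here p)
lift ρ (there v) with ρ v
... | inj₁ c = inj₁ c
... | inj₂ w = inj₂ (there w)

mutual
  renP : ∀ {Γ Δ} → Ren Γ Δ → Pred Γ → Pred Δ
  renP ρ (and Xs) = and (renL ρ Xs)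
  renP ρ (neg X) = neg (renP ρ X)
  renP ρ (all l X) = all l (renP (lift ρ) X)
  renP ρ (elt y c) = elt (renT ρ y) c
  renP ρ (eltB y v) with ρ v
  ... | inj₁ c = elt (renT ρ y) c
  ... | inj₂ w = eltB (renT ρ y) w

  renL : ∀ {Γ Δ} → Ren Γ Δ → List (Pred Γ) → List (Pred Δ)
  renL ρ [] = []
  renL ρ (X ∷ Xs) = renP ρ X ∷ renL ρ Xs

  renT : ∀ {Γ Δ k} → Ren Γ Δ → SetT Γ k → SetT Δ k
  renT ρ (atm c) = atm c
  renT ρ (atmB v) with ρ v
  ... | inj₁ c = atm c
  ... | inj₂ w = atmB w
  renT ρ (st X) = st (renP (lift ρ) X)

wk : ∀ {Γ l k} → SetT Γ k → SetT (l ∷ Γ) k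
wk = renT (λ v → inj₂ (there v))

openR : ∀ {Γ k} → Atom k → Ren (k ∷ Γ) Γ
openR a' (here refl) = inj₁ a'
openR a' (there v) = inj₂ v

openP : ∀ {Γ k} → Atom k → Pred (k ∷ Γ) → Pred Γ
openP a' = renP (openR a')

maxℕ : List ℕ → ℕ
maxℕ = foldr _⊔_ 0

-- Fuel decreases only
-- in the clause elt(y,a)[a↦st([a']X')] = X'[a'↦y[a↦st([a']X')]], whose
-- substituted atom a' has level one lower; the fuel supplied by the
-- top-level operations below always suffices, so the 'fuel exhausted'
-- clause is never reached.

mutual
  sP : ∀ {Γ i} → ℕ → Atom i → SetT Γ i → Pred Γ → Pred Γ
  sP n a x (and Xs) = and (sL n a x Xs)
  sP n a x (neg X) = neg (sP n a x X)
  sP n a x (all l X) = all l (sP n a (wk x) X)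
  sP n a x (eltB y v) = eltB (sT n a x y) v
  sP {i = i} n a x (elt {l} y c) with l ℤ.≟ i
  ... | no _ = elt (sT n a x y) c
  ... | yes refl with name c ℕ.≟ name a
  ...   | no _ = elt (sT n a x y) c
  ...   | yes _ = hit n (sT n a x y) x

  -- elt(y', a)[a ↦ x] once y' = y[a↦x] has been computed
  hit : ∀ {Γ i} → ℕ → SetT Γ (ℤ.pred i) → SetT Γ i → Pred Γ
  hit n y' (atm c) = elt y' c
  hit n y' (atmB v) = eltB y' v
  hit zero y' (st X') = and []
  hit {i = i} (suc n) y' (st X') =
    sP n a' y' (openP a' X')
    where
    a' : Atom (ℤ.pred i)
    a' = at (suc (maxℕ (atomsP (ℤ.pred i) X' ++ atomsT (ℤ.pred i) y')))

  sL : ∀ {Γ i} → ℕ → Atom i → SetT Γ i → List (Pred Γ) → List (Pred Γ)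
  sL n a x [] = []
  sL n a x (X ∷ Xs) = sP n a x X ∷ sL n a x Xs

  sT : ∀ {Γ i k} → ℕ → Atom i → SetT Γ i → SetT Γ k → SetT Γ k
  sT {i = i} {k = k} n a x (atm c) with k ℤ.≟ i
  ... | no _ = atm c
  ... | yes refl with name c ℕ.≟ name a
  ...   | no _ = atm c
  ...   | yes _ = x
  sT n a x (atmB v) = atmB v
  sT n a x (st X) = st (sP n a (wk x) X)

fuel : ℤ → List ℤ → ℕ
fuel i ls = suc (sum (map (λ l → ∣ i - l ∣) ls))

_[_↦_]P : ∀ {Γ i} → Pred Γ → Atom i → SetT Γ i → Pred Γ
_[_↦_]P {i = i} Z a x = sP (fuel i (stP Z ++ stT x)) a x Z

_[_↦_]T : ∀ {Γ i k} → SetT Γ k → Atom i → SetT Γ i → SetT Γ k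
_[_↦_]T {i = i} z a x = sT (fuel i (stT z ++ stT x)) a x z

module Submission where

-- The substitution (sigma-action) Z[a ↦ x] is defined in Defs by recursion
-- on fuel, which is awkward to reason about directly.  We therefore
--   1. characterise it by an inductive graph  SubP a x Z R  ("R is Z[a ↦ x]"),
--      whose clause for elt(y,a)[a ↦ st([a']X')] quantifies over ALL atoms a'
--      fresh for X' and y;
--   2. develop the nominal facts about this graph: it is equivariant under
--      atom swappings (so one fresh a' suffices, as in the paper), stable
--      under renaming of bound variables, does not create atoms, fixes terms
--      in which a is fresh, and is deterministic;
--   3. show that the fuel-based operations of Defs compute a result related
--      by the graph whenever the fuel bounds the chain of levels below i
--      (the top-level fuel always does);
--   4. prove the substitution lemma on graphs,
--         Z[a ↦ x][b ↦ y] = Z[b ↦ y][a ↦ x[b ↦ y]]   when a ≠ b and a # y,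
--      by induction on the terms and on the descending chains of levels
--      through which the st-clause unfolds.
-- The corollary is the special case b # x, where x[b ↦ y] = x.

open import Defs
open import Data.Integer using (ℤ)
open import Data.List using ([])
open import Data.Product using (_×_)
open import Relation.Binary.PropositionalEquality using (_≡_)

open import Data.Nat as ℕ using (ℕ; zero; suc)
import Data.Nat.Properties as ℕP
open import Data.Nat.ListAction using (sum)
open import Data.Integer as ℤ using (_-_; ∣_∣)
import Data.Integer.Properties as ℤP
open import Data.List using (List; _∷_; _++_; map)
open import Data.List.Properties using (map-++)
open import Data.List.Membership.Propositional using (_∈_; _∉_)
open import Data.List.Membership.Propositional.Properties using (∈-++⁺ˡ; ∈-++⁺ʳ; ∈-++⁻; ∈-map⁺)
open import Data.List.Relation.Unary.Any using (here; there)
open import Data.List.Relation.Binary.Subset.Propositional using (_⊆_)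
open import Data.List.Relation.Binary.Subset.Propositional.Properties using (xs⊆xs++ys; xs⊆ys++xs; ⊆-trans)
open import Data.Sum using (_⊎_; inj₁; inj₂; [_,_]′; map₁; map₂)
open import Data.Product using (Σ; _,_; proj₁; proj₂)
open import Data.Empty using (⊥; ⊥-elim)
open import Relation.Nullary using (yes; no; Dec)
open import Relation.Binary.PropositionalEquality using (_≢_; refl; sym; trans; cong; cong₂; subst; subst₂)

AtomΣ : Set
AtomΣ = Σ ℤ Atom

≡Σ⇒name : ∀ {i j} {a : Atom i} {b : Atom j} → _≡_ {A = AtomΣ} (i , a) (j , b) → name a ≡ name b
≡Σ⇒name refl = refl

≡Σ⇒level : ∀ {i j} {a : Atom i} {b : Atom j} → _≡_ {A = AtomΣ} (i , a) (j , b) → i ≡ j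
≡Σ⇒level refl = refl

name⇒≡Σ : ∀ {i} {a b : Atom i} → name a ≡ name b → _≡_ {A = AtomΣ} (i , a) (i , b)
name⇒≡Σ refl = refl

name⇒≡ : ∀ {i} {a b : Atom i} → name a ≡ name b → a ≡ b
name⇒≡ refl = refl

_≟Σ_ : (p q : AtomΣ) → Dec (p ≡ q)
(i , a) ≟Σ (j , b) with i ℤ.≟ j
... | no i≢j = no (λ e → i≢j (≡Σ⇒level e))
... | yes refl with name a ℕ.≟ name b
...   | yes e = yes (name⇒≡Σ e)
...   | no a≢b = no (λ e → a≢b (≡Σ⇒name e))

name≢⇒Distinct : ∀ {i j} {a : Atom i} {b : Atom j} → name a ≢ name b → Distinct a b
name≢⇒Distinct a≢b e = a≢b (≡Σ⇒name e)

∈elt⁻ : ∀ {Γ l k n} (y : SetT Γ (ℤ.pred k)) (c : Atom k) → n ∈ atomsP l (elt y c) →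
        (k ≡ l × n ≡ name c) ⊎ n ∈ atomsT l y
∈elt⁻ {l = l} {k} y c p with k ℤ.≟ l
∈elt⁻ y c (here q) | yes e = inj₁ (e , q)
∈elt⁻ y c (there p) | yes e = inj₂ p
∈elt⁻ y c p | no _ = inj₂ p

∈elt-atom : ∀ {Γ l k} (y : SetT Γ (ℤ.pred k)) (c : Atom k) → k ≡ l → name c ∈ atomsP l (elt y c)
∈elt-atom {l = l} {k} y c e with k ℤ.≟ l
... | yes _ = here refl
... | no k≢l = ⊥-elim (k≢l e)

∈elt-set : ∀ {Γ l k n} (y : SetT Γ (ℤ.pred k)) (c : Atom k) → n ∈ atomsT l y → n ∈ atomsP l (elt y c)
∈elt-set {l = l} {k} y c p with k ℤ.≟ l
... | yes _ = there p
... | no _ = p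

∈atm⁻ : ∀ {Γ l k n} {c : Atom k} → n ∈ atomsT {Γ} l (atm c) → k ≡ l × n ≡ name c
∈atm⁻ {l = l} {k} p with k ℤ.≟ l
∈atm⁻ (here q) | yes e = e , q
∈atm⁻ () | no _

∈atm⁺ : ∀ {Γ l k} {c : Atom k} → k ≡ l → name c ∈ atomsT {Γ} l (atm c)
∈atm⁺ {l = l} {k} e with k ℤ.≟ l
... | yes _ = here refl
... | no k≢l = ⊥-elim (k≢l e)

#atm⇒Distinct : ∀ {Γ i k} {a : Atom i} {c : Atom k} → a # atm {Γ} c → Distinct c a
#atm⇒Distinct {Γ} {c = c} a# refl = a# (∈atm⁺ {Γ} {c = c} refl)

max-upper : ∀ {n} xs → n ∈ xs → n ℕ.≤ maxℕ xs
max-upper (x ∷ xs) (here refl) = ℕP.m≤m⊔n x (maxℕ xs)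
max-upper (x ∷ xs) (there p) = ℕP.≤-trans (max-upper xs p) (ℕP.m≤n⊔m x (maxℕ xs))

freshName : List ℕ → ℕ
freshName xs = suc (maxℕ xs)

freshName∉ : ∀ xs → freshName xs ∉ xs
freshName∉ xs p = ℕP.<-irrefl refl (max-upper xs p)

freshAtom : ∀ {l} → List ℕ → Atom l
freshAtom xs = at (freshName xs)

∉-++⁻ˡ : ∀ {n : ℕ} xs {ys} → n ∉ xs ++ ys → n ∉ xs
∉-++⁻ˡ xs n∉ p = n∉ (∈-++⁺ˡ p)

∉-++⁻ʳ : ∀ {n : ℕ} xs {ys} → n ∉ xs ++ ys → n ∉ ys
∉-++⁻ʳ xs n∉ p = n∉ (∈-++⁺ʳ xs p)

∉-++⁺ : ∀ {n : ℕ} {xs ys} → n ∉ xs → n ∉ ys → n ∉ xs ++ ys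
∉-++⁺ {xs = xs} n∉xs n∉ys p with ∈-++⁻ xs p
... | inj₁ q = n∉xs q
... | inj₂ q = n∉ys q

atmOr : ∀ {Δ i} → Atom i ⊎ i ∈ Δ → SetT Δ i
atmOr = [ atm , atmB ]′

eltOr : ∀ {Δ i} → SetT Δ (ℤ.pred i) → Atom i ⊎ i ∈ Δ → Pred Δ
eltOr {i = i} y = [ elt {i = i} y , eltB y ]′

renT-atmB : ∀ {Γ Δ i} (ρ : Ren Γ Δ) (v : i ∈ Γ) → renT ρ (atmB v) ≡ atmOr (ρ v)
renT-atmB ρ v with ρ v
... | inj₁ c = refl
... | inj₂ w = refl

renP-eltB : ∀ {Γ Δ i} (ρ : Ren Γ Δ) (y : SetT Γ (ℤ.pred i)) (v : i ∈ Γ) →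
  renP ρ (eltB y v) ≡ eltOr (renT ρ y) (ρ v)
renP-eltB ρ y v with ρ v
... | inj₁ c = refl
... | inj₂ w = refl

lift-there : ∀ {Γ Δ k l} (ρ : Ren Γ Δ) (v : l ∈ Γ) → lift {k = k} ρ (there v) ≡ map₂ there (ρ v)
lift-there ρ v with ρ v
... | inj₁ c = refl
... | inj₂ w = refl

_≗R_ : ∀ {Γ Δ} → Ren Γ Δ → Ren Γ Δ → Set
_≗R_ {Γ} ρ σ = ∀ {l} (v : l ∈ Γ) → ρ v ≡ σ v

lift-cong : ∀ {Γ Δ k} {ρ σ : Ren Γ Δ} → ρ ≗R σ → lift {k = k} ρ ≗R lift σ
lift-cong ρ≗σ (here p) = refl
lift-cong {ρ = ρ} {σ} ρ≗σ (there v) =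
  trans (lift-there ρ v) (trans (cong (map₂ there) (ρ≗σ v)) (sym (lift-there σ v)))

mutual
  renP-cong : ∀ {Γ Δ} {ρ σ : Ren Γ Δ} → ρ ≗R σ → (X : Pred Γ) → renP ρ X ≡ renP σ X
  renP-cong ρ≗σ (and Xs) = cong and (renL-cong ρ≗σ Xs)
  renP-cong ρ≗σ (neg X) = cong neg (renP-cong ρ≗σ X)
  renP-cong ρ≗σ (all l X) = cong (all l) (renP-cong (lift-cong ρ≗σ) X)
  renP-cong ρ≗σ (elt y c) = cong (λ t → elt t c) (renT-cong ρ≗σ y)
  renP-cong {ρ = ρ} {σ} ρ≗σ (eltB y v) =
    trans (renP-eltB ρ y v) (trans (cong₂ eltOr (renT-cong ρ≗σ y) (ρ≗σ v)) (sym (renP-eltB σ y v)))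

  renL-cong : ∀ {Γ Δ} {ρ σ : Ren Γ Δ} → ρ ≗R σ → (Xs : List (Pred Γ)) → renL ρ Xs ≡ renL σ Xs
  renL-cong ρ≗σ [] = refl
  renL-cong ρ≗σ (X ∷ Xs) = cong₂ _∷_ (renP-cong ρ≗σ X) (renL-cong ρ≗σ Xs)

  renT-cong : ∀ {Γ Δ k} {ρ σ : Ren Γ Δ} → ρ ≗R σ → (x : SetT Γ k) → renT ρ x ≡ renT σ x
  renT-cong ρ≗σ (atm c) = refl
  renT-cong {ρ = ρ} {σ} ρ≗σ (atmB v) =
    trans (renT-atmB ρ v) (trans (cong atmOr (ρ≗σ v)) (sym (renT-atmB σ v)))
  renT-cong ρ≗σ (st X) = cong st (renP-cong (lift-cong ρ≗σ) X)

_⊚_ : ∀ {Γ Δ Θ} → Ren Δ Θ → Ren Γ Δ → Ren Γ Θ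
(ρ ⊚ σ) v = [ inj₁ , ρ ]′ (σ v)

lift-⊚ : ∀ {Γ Δ Θ k} (ρ : Ren Δ Θ) (σ : Ren Γ Δ) → (lift ρ ⊚ lift σ) ≗R lift {k = k} (ρ ⊚ σ)
lift-⊚ ρ σ (here p) = refl
lift-⊚ ρ σ (there v) =
  trans (cong [ inj₁ , lift ρ ]′ (lift-there σ v)) (trans (step (σ v)) (sym (lift-there (ρ ⊚ σ) v)))
  where
  step : ∀ s → [ inj₁ , lift ρ ]′ (map₂ there s) ≡ map₂ there ([ inj₁ , ρ ]′ s)
  step (inj₁ c) = refl
  step (inj₂ w) = lift-there ρ w

mutual
  renP-⊚ : ∀ {Γ Δ Θ} (ρ : Ren Δ Θ) (σ : Ren Γ Δ) (X : Pred Γ) → renP ρ (renP σ X) ≡ renP (ρ ⊚ σ) X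
  renP-⊚ ρ σ (and Xs) = cong and (renL-⊚ ρ σ Xs)
  renP-⊚ ρ σ (neg X) = cong neg (renP-⊚ ρ σ X)
  renP-⊚ ρ σ (all l X) = cong (all l) (trans (renP-⊚ (lift ρ) (lift σ) X) (renP-cong (lift-⊚ ρ σ) X))
  renP-⊚ ρ σ (elt y c) = cong (λ t → elt t c) (renT-⊚ ρ σ y)
  renP-⊚ ρ σ (eltB y v) =
    trans (cong (renP ρ) (renP-eltB σ y v))
      (trans (step (σ v))
        (trans (cong (λ t → eltOr t ([ inj₁ , ρ ]′ (σ v))) (renT-⊚ ρ σ y)) (sym (renP-eltB (ρ ⊚ σ) y v))))
    where
    step : ∀ s → renP ρ (eltOr (renT σ y) s) ≡ eltOr (renT ρ (renT σ y)) ([ inj₁ , ρ ]′ s)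
    step (inj₁ c) = refl
    step (inj₂ w) = renP-eltB ρ (renT σ y) w

  renL-⊚ : ∀ {Γ Δ Θ} (ρ : Ren Δ Θ) (σ : Ren Γ Δ) (Xs : List (Pred Γ)) → renL ρ (renL σ Xs) ≡ renL (ρ ⊚ σ) Xs
  renL-⊚ ρ σ [] = refl
  renL-⊚ ρ σ (X ∷ Xs) = cong₂ _∷_ (renP-⊚ ρ σ X) (renL-⊚ ρ σ Xs)

  renT-⊚ : ∀ {Γ Δ Θ k} (ρ : Ren Δ Θ) (σ : Ren Γ Δ) (x : SetT Γ k) → renT ρ (renT σ x) ≡ renT (ρ ⊚ σ) x
  renT-⊚ ρ σ (atm c) = refl
  renT-⊚ ρ σ (atmB v) = trans (cong (renT ρ) (renT-atmB σ v)) (trans (step (σ v)) (sym (renT-atmB (ρ ⊚ σ) v)))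
    where
    step : ∀ s → renT ρ (atmOr s) ≡ atmOr ([ inj₁ , ρ ]′ s)
    step (inj₁ c) = refl
    step (inj₂ w) = renT-atmB ρ w
  renT-⊚ ρ σ (st X) = cong st (trans (renP-⊚ (lift ρ) (lift σ) X) (renP-cong (lift-⊚ ρ σ) X))

idR : ∀ {Γ} → Ren Γ Γ
idR v = inj₂ v

lift-idR : ∀ {Γ k} → lift {Γ} {Γ} {k} idR ≗R idR
lift-idR (here p) = refl
lift-idR (there v) = refl

mutual
  renP-idR : ∀ {Γ} (X : Pred Γ) → renP idR X ≡ X
  renP-idR (and Xs) = cong and (renL-idR Xs)
  renP-idR (neg X) = cong neg (renP-idR X)
  renP-idR (all l X) = cong (all l) (trans (renP-cong lift-idR X) (renP-idR X))
  renP-idR (elt y c) = cong (λ t → elt t c) (renT-idR y)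
  renP-idR (eltB y v) = cong (λ t → eltB t v) (renT-idR y)

  renL-idR : ∀ {Γ} (Xs : List (Pred Γ)) → renL idR Xs ≡ Xs
  renL-idR [] = refl
  renL-idR (X ∷ Xs) = cong₂ _∷_ (renP-idR X) (renL-idR Xs)

  renT-idR : ∀ {Γ k} (x : SetT Γ k) → renT idR x ≡ x
  renT-idR (atm c) = refl
  renT-idR (atmB v) = refl
  renT-idR (st X) = cong st (trans (renP-cong lift-idR X) (renP-idR X))

wkR : ∀ {Γ l} → Ren Γ (l ∷ Γ)
wkR v = inj₂ (there v)

open-wk : ∀ {Γ k l} (x : SetT Γ k) (a' : Atom l) → renT (openR a') (wk x) ≡ x
open-wk x a' = trans (renT-⊚ (openR a') wkR x) (renT-idR x)

lift-wk : ∀ {Γ Δ k l} (ρ : Ren Γ Δ) (x : SetT Γ k) → renT (lift {k = l} ρ) (wk x) ≡ wk (renT ρ x)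
lift-wk ρ x = trans (renT-⊚ (lift ρ) wkR x) (trans (renT-cong commute x) (sym (renT-⊚ wkR ρ x)))
  where
  step : ∀ {m} (s : Atom m ⊎ _) → map₂ there s ≡ [ inj₁ , wkR ]′ s
  step (inj₁ c) = refl
  step (inj₂ w) = refl
  commute : (lift ρ ⊚ wkR) ≗R (wkR ⊚ ρ)
  commute v = trans (lift-there ρ v) (step (ρ v))

open-lift : ∀ {Γ Δ k} (ρ : Ren Γ Δ) (a' : Atom k) (X : Pred (k ∷ Γ)) →
  renP ρ (openP a' X) ≡ openP a' (renP (lift ρ) X)
open-lift ρ a' X = trans (renP-⊚ ρ (openR a') X) (trans (renP-cong commute X) (sym (renP-⊚ (openR a') (lift ρ) X)))
  where
  step : ∀ {m} (s : Atom m ⊎ _) → s ≡ [ inj₁ , openR a' ]′ (map₂ there s)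
  step (inj₁ c) = refl
  step (inj₂ w) = refl
  commute : (ρ ⊚ openR a') ≗R (openR a' ⊚ lift ρ)
  commute (here refl) = refl
  commute (there v) = trans (step (ρ v)) (cong [ inj₁ , openR a' ]′ (sym (lift-there ρ v)))

RenHit : ∀ {Γ Δ} → Ren Γ Δ → ℤ → ℕ → Set
RenHit {Γ} ρ l n = Σ (l ∈ Γ) (λ v → ρ v ≡ inj₁ (at n))

lift-inj₁ : ∀ {Γ Δ k l} (ρ : Ren Γ Δ) (v : l ∈ (k ∷ Γ)) (c : Atom l) → lift ρ v ≡ inj₁ c →
  Σ (l ∈ Γ) (λ u → ρ u ≡ inj₁ c)
lift-inj₁ ρ (here p) c ()
lift-inj₁ ρ (there u) c e = u , unmap (ρ u) (trans (sym (lift-there ρ u)) e)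
  where
  unmap : ∀ s → map₂ there s ≡ inj₁ c → s ≡ inj₁ c
  unmap (inj₁ _) refl = refl
  unmap (inj₂ _) ()

lift-RenHit : ∀ {Γ Δ k l n} (ρ : Ren Γ Δ) → RenHit (lift {k = k} ρ) l n → RenHit ρ l n
lift-RenHit ρ (v , e) = lift-inj₁ ρ v _ e

mutual
  atomsP-ren : ∀ {Γ Δ l n} (ρ : Ren Γ Δ) (X : Pred Γ) → n ∈ atomsP l (renP ρ X) → n ∈ atomsP l X ⊎ RenHit ρ l n
  atomsP-ren ρ (and Xs) p = atomsL-ren ρ Xs p
  atomsP-ren ρ (neg X) p = atomsP-ren ρ X p
  atomsP-ren ρ (all l X) p = map₂ (lift-RenHit ρ) (atomsP-ren (lift ρ) X p)
  atomsP-ren ρ (elt y c) p with ∈elt⁻ (renT ρ y) c p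
  ... | inj₁ (e , refl) = inj₁ (∈elt-atom y c e)
  ... | inj₂ q = map₁ (∈elt-set y c) (atomsT-ren ρ y q)
  atomsP-ren {l = l} {n} ρ (eltB y v) p = cases (ρ v) refl (subst (λ Z → n ∈ atomsP l Z) (renP-eltB ρ y v) p)
    where
    cases : ∀ s → ρ v ≡ s → n ∈ atomsP l (eltOr (renT ρ y) s) → n ∈ atomsT l y ⊎ RenHit ρ l n
    cases (inj₁ c) eq q with ∈elt⁻ (renT ρ y) c q
    ... | inj₁ (refl , refl) = inj₂ (v , eq)
    ... | inj₂ r = atomsT-ren ρ y r
    cases (inj₂ w) eq q = atomsT-ren ρ y q

  atomsL-ren : ∀ {Γ Δ l n} (ρ : Ren Γ Δ) (Xs : List (Pred Γ)) → n ∈ atomsL l (renL ρ Xs) → n ∈ atomsL l Xs ⊎ RenHit ρ l n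
  atomsL-ren ρ (X ∷ Xs) p with ∈-++⁻ (atomsP _ (renP ρ X)) p
  ... | inj₁ q = map₁ ∈-++⁺ˡ (atomsP-ren ρ X q)
  ... | inj₂ q = map₁ (∈-++⁺ʳ (atomsP _ X)) (atomsL-ren ρ Xs q)

  atomsT-ren : ∀ {Γ Δ l n k} (ρ : Ren Γ Δ) (x : SetT Γ k) → n ∈ atomsT l (renT ρ x) → n ∈ atomsT l x ⊎ RenHit ρ l n
  atomsT-ren ρ (atm c) p = inj₁ p
  atomsT-ren {Γ} {Δ} {l = l} {n} ρ (atmB v) p = cases (ρ v) refl (subst (λ z → n ∈ atomsT l z) (renT-atmB ρ v) p)
    where
    cases : ∀ s → ρ v ≡ s → n ∈ atomsT l (atmOr s) → n ∈ atomsT l (atmB {Γ} v) ⊎ RenHit ρ l n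
    cases (inj₁ c) eq q with ∈atm⁻ {Δ} {c = c} q
    ... | refl , refl = inj₂ (v , eq)
    cases (inj₂ w) eq ()
  atomsT-ren ρ (st X) p = map₂ (lift-RenHit ρ) (atomsP-ren (lift ρ) X p)

∈wk⁻ : ∀ {Γ l n k m} (x : SetT Γ k) → n ∈ atomsT l (wk {l = m} x) → n ∈ atomsT l x
∈wk⁻ x p with atomsT-ren wkR x p
... | inj₁ q = q
... | inj₂ (v , ())

∈open⁻ : ∀ {Γ l n k} (a' : Atom k) (X : Pred (k ∷ Γ)) → n ∈ atomsP l (openP a' X) →
         n ∈ atomsP l X ⊎ _≡_ {A = AtomΣ} (l , at n) (k , a')
∈open⁻ a' X p with atomsP-ren (openR a') X p
... | inj₁ q = inj₁ q
... | inj₂ (here refl , refl) = inj₂ refl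
... | inj₂ (there v , ())

mutual
  stP-ren : ∀ {Γ Δ} (ρ : Ren Γ Δ) (X : Pred Γ) → stP (renP ρ X) ≡ stP X
  stP-ren ρ (and Xs) = stL-ren ρ Xs
  stP-ren ρ (neg X) = stP-ren ρ X
  stP-ren ρ (all l X) = stP-ren (lift ρ) X
  stP-ren ρ (elt y c) = stT-ren ρ y
  stP-ren ρ (eltB y v) = trans (cong stP (renP-eltB ρ y v)) (trans (cases (ρ v)) (stT-ren ρ y))
    where
    cases : ∀ s → stP (eltOr (renT ρ y) s) ≡ stT (renT ρ y)
    cases (inj₁ c) = refl
    cases (inj₂ w) = refl

  stL-ren : ∀ {Γ Δ} (ρ : Ren Γ Δ) (Xs : List (Pred Γ)) → stL (renL ρ Xs) ≡ stL Xs
  stL-ren ρ [] = refl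
  stL-ren ρ (X ∷ Xs) = cong₂ _++_ (stP-ren ρ X) (stL-ren ρ Xs)

  stT-ren : ∀ {Γ Δ k} (ρ : Ren Γ Δ) (x : SetT Γ k) → stT (renT ρ x) ≡ stT x
  stT-ren ρ (atm c) = refl
  stT-ren ρ (atmB v) = trans (cong stT (renT-atmB ρ v)) (cases (ρ v))
    where
    cases : ∀ s → stT (atmOr s) ≡ []
    cases (inj₁ c) = refl
    cases (inj₂ w) = refl
  stT-ren ρ (st X) = cong (_ ∷_) (stP-ren (lift ρ) X)

-- Swappings (c d) of two names at one level, acting on terms

swapℕ : ℕ → ℕ → ℕ → ℕ
swapℕ c d n with n ℕ.≟ c
... | yes _ = d
... | no _ with n ℕ.≟ d
...   | yes _ = c
...   | no _ = n

swapℕ-left : ∀ c d → swapℕ c d c ≡ d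
swapℕ-left c d with c ℕ.≟ c
... | yes _ = refl
... | no c≢c = ⊥-elim (c≢c refl)

swapℕ-right : ∀ c d → swapℕ c d d ≡ c
swapℕ-right c d with d ℕ.≟ c
... | yes e = e
... | no _ with d ℕ.≟ d
...   | yes _ = refl
...   | no d≢d = ⊥-elim (d≢d refl)

swapℕ-other : ∀ c d n → n ≢ c → n ≢ d → swapℕ c d n ≡ n
swapℕ-other c d n n≢c n≢d with n ℕ.≟ c
... | yes e = ⊥-elim (n≢c e)
... | no _ with n ℕ.≟ d
...   | yes e = ⊥-elim (n≢d e)
...   | no _ = refl

swapℕ-invol : ∀ c d n → swapℕ c d (swapℕ c d n) ≡ n
swapℕ-invol c d n with n ℕ.≟ c
... | yes refl = swapℕ-right n d
... | no n≢c with n ℕ.≟ d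
...   | yes refl = swapℕ-left c n
...   | no n≢d = swapℕ-other c d n n≢c n≢d

record Swap : Set where
  constructor swap
  field
    lev : ℤ
    c d : ℕ
open Swap public

swapName : Swap → ℤ → ℕ → ℕ
swapName π l n with l ℤ.≟ lev π
... | yes _ = swapℕ (c π) (d π) n
... | no _ = n

swapName-invol : ∀ π l n → swapName π l (swapName π l n) ≡ n
swapName-invol π l n with l ℤ.≟ lev π
... | yes _ = swapℕ-invol (c π) (d π) n
... | no _ = refl

swapName-other : ∀ π l n → (l ≡ lev π → n ≢ c π × n ≢ d π) → swapName π l n ≡ n
swapName-other π l n fresh with l ℤ.≟ lev π
... | yes e = swapℕ-other (c π) (d π) n (proj₁ (fresh e)) (proj₂ (fresh e))
... | no _ = refl

swapAtom : ∀ {l} → Swap → Atom l → Atom l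
swapAtom {l} π a = at (swapName π l (name a))

swapAtom-invol : ∀ {l} π (a : Atom l) → swapAtom π (swapAtom π a) ≡ a
swapAtom-invol {l} π a = cong at (swapName-invol π l (name a))

swapAtom-left : ∀ {l} (a b : Atom l) → swapAtom (swap l (name a) (name b)) a ≡ b
swapAtom-left {l} a b with l ℤ.≟ l
... | yes _ = cong at (swapℕ-left (name a) (name b))
... | no l≢l = ⊥-elim (l≢l refl)

swapAtom-Distinct : ∀ {i j} π {a : Atom i} {b : Atom j} → Distinct a b → Distinct (swapAtom π a) (swapAtom π b)
swapAtom-Distinct {i} π {a} {b} a≢b e with ≡Σ⇒level e
... | refl = a≢b (name⇒≡Σ (trans (sym (swapName-invol π i (name a)))
                            (trans (cong (swapName π i) (≡Σ⇒name e)) (swapName-invol π i (name b)))))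

mutual
  swapP : ∀ {Γ} → Swap → Pred Γ → Pred Γ
  swapP π (and Xs) = and (swapL π Xs)
  swapP π (neg X) = neg (swapP π X)
  swapP π (all l X) = all l (swapP π X)
  swapP π (elt y c) = elt (swapT π y) (swapAtom π c)
  swapP π (eltB y v) = eltB (swapT π y) v

  swapL : ∀ {Γ} → Swap → List (Pred Γ) → List (Pred Γ)
  swapL π [] = []
  swapL π (X ∷ Xs) = swapP π X ∷ swapL π Xs

  swapT : ∀ {Γ k} → Swap → SetT Γ k → SetT Γ k
  swapT π (atm c) = atm (swapAtom π c)
  swapT π (atmB v) = atmB v
  swapT π (st X) = st (swapP π X)

mutual
  atomsP-swap : ∀ {Γ} π l (X : Pred Γ) → atomsP l (swapP π X) ≡ map (swapName π l) (atomsP l X)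
  atomsP-swap π l (and Xs) = atomsL-swap π l Xs
  atomsP-swap π l (neg X) = atomsP-swap π l X
  atomsP-swap π l (all _ X) = atomsP-swap π l X
  atomsP-swap π l (elt {k} y c) with k ℤ.≟ l
  ... | yes refl = cong (_ ∷_) (atomsT-swap π l y)
  ... | no _ = atomsT-swap π l y
  atomsP-swap π l (eltB y v) = atomsT-swap π l y

  atomsL-swap : ∀ {Γ} π l (Xs : List (Pred Γ)) → atomsL l (swapL π Xs) ≡ map (swapName π l) (atomsL l Xs)
  atomsL-swap π l [] = refl
  atomsL-swap π l (X ∷ Xs) =
    trans (cong₂ _++_ (atomsP-swap π l X) (atomsL-swap π l Xs)) (sym (map-++ (swapName π l) (atomsP l X) (atomsL l Xs)))

  atomsT-swap : ∀ {Γ k} π l (x : SetT Γ k) → atomsT l (swapT π x) ≡ map (swapName π l) (atomsT l x)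
  atomsT-swap {k = k} π l (atm c) with k ℤ.≟ l
  ... | yes refl = refl
  ... | no _ = refl
  atomsT-swap π l (atmB v) = refl
  atomsT-swap π l (st X) = atomsP-swap π l X

swap-∉P : ∀ {Γ} π l n (X : Pred Γ) → n ∉ atomsP l (swapP π X) → swapName π l n ∉ atomsP l X
swap-∉P π l n X n∉ p =
  n∉ (subst (_∈ atomsP l (swapP π X)) (swapName-invol π l n) (subst (_ ∈_) (sym (atomsP-swap π l X)) (∈-map⁺ (swapName π l) p)))

swap-∉T : ∀ {Γ k} π l n (x : SetT Γ k) → n ∉ atomsT l (swapT π x) → swapName π l n ∉ atomsT l x
swap-∉T π l n x n∉ p =
  n∉ (subst (_∈ atomsT l (swapT π x)) (swapName-invol π l n) (subst (_ ∈_) (sym (atomsT-swap π l x)) (∈-map⁺ (swapName π l) p)))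

SwapFresh : Swap → List ℕ → Set
SwapFresh π xs = c π ∉ xs × d π ∉ xs

SwapFresh-++ˡ : ∀ π xs {ys} → SwapFresh π (xs ++ ys) → SwapFresh π xs
SwapFresh-++ˡ π xs (c∉ , d∉) = ∉-++⁻ˡ xs c∉ , ∉-++⁻ˡ xs d∉

SwapFresh-++ʳ : ∀ π xs {ys} → SwapFresh π (xs ++ ys) → SwapFresh π ys
SwapFresh-++ʳ π xs (c∉ , d∉) = ∉-++⁻ʳ xs c∉ , ∉-++⁻ʳ xs d∉

swapAtom-fixed : ∀ {l} π (a : Atom l) → (l ≡ lev π → SwapFresh π (name a ∷ [])) → swapAtom π a ≡ a
swapAtom-fixed {l} π a fresh =
  cong at (swapName-other π l (name a) (λ e → (λ q → proj₁ (fresh e) (here (sym q))) , (λ q → proj₂ (fresh e) (here (sym q)))))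

atom-SwapFresh : ∀ {k} π (c : Atom k) (xs : List ℕ) → (k ≡ lev π → name c ∈ xs) → SwapFresh π xs →
                 k ≡ lev π → SwapFresh π (name c ∷ [])
atom-SwapFresh π c xs c∈ (c∉ , d∉) e =
  (λ { (here q) → c∉ (subst (_∈ xs) (sym q) (c∈ e)) ; (there ()) }) ,
  (λ { (here q) → d∉ (subst (_∈ xs) (sym q) (c∈ e)) ; (there ()) })

mutual
  swapP-fixed : ∀ {Γ} π (X : Pred Γ) → SwapFresh π (atomsP (lev π) X) → swapP π X ≡ X
  swapP-fixed π (and Xs) fr = cong and (swapL-fixed π Xs fr)
  swapP-fixed π (neg X) fr = cong neg (swapP-fixed π X fr)
  swapP-fixed π (all l X) fr = cong (all l) (swapP-fixed π X fr)
  swapP-fixed π (elt y c) (c∉ , d∉) =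
    cong₂ elt (swapT-fixed π y ((λ p → c∉ (∈elt-set y c p)) , (λ p → d∉ (∈elt-set y c p))))
              (swapAtom-fixed π c (atom-SwapFresh π c _ (λ { refl → ∈elt-atom y c refl }) (c∉ , d∉)))
  swapP-fixed π (eltB y v) fr = cong (λ t → eltB t v) (swapT-fixed π y fr)

  swapL-fixed : ∀ {Γ} π (Xs : List (Pred Γ)) → SwapFresh π (atomsL (lev π) Xs) → swapL π Xs ≡ Xs
  swapL-fixed π [] fr = refl
  swapL-fixed π (X ∷ Xs) fr =
    cong₂ _∷_ (swapP-fixed π X (SwapFresh-++ˡ π (atomsP _ X) fr)) (swapL-fixed π Xs (SwapFresh-++ʳ π (atomsP _ X) fr))

  swapT-fixed : ∀ {Γ k} π (x : SetT Γ k) → SwapFresh π (atomsT (lev π) x) → swapT π x ≡ x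
  swapT-fixed {Γ} π (atm c) fr =
    cong atm (swapAtom-fixed π c (atom-SwapFresh π c _ (λ { refl → ∈atm⁺ {Γ} {c = c} refl }) fr))
  swapT-fixed π (atmB v) fr = refl
  swapT-fixed π (st X) fr = cong st (swapP-fixed π X fr)

swapR : ∀ {Γ Δ} → Swap → Ren Γ Δ → Ren Γ Δ
swapR π ρ v = map₁ (swapAtom π) (ρ v)

lift-swapR : ∀ {Γ Δ k} π (ρ : Ren Γ Δ) → lift {k = k} (swapR π ρ) ≗R swapR π (lift ρ)
lift-swapR π ρ (here p) = refl
lift-swapR {Γ} {Δ} {k} π ρ (there v) =
  trans (lift-there (swapR π ρ) v) (trans (step (ρ v)) (cong (map₁ (swapAtom π)) (sym (lift-there ρ v))))
  where
  step : ∀ {m} (s : Atom m ⊎ m ∈ Δ) → map₂ (there {x = k}) (map₁ (swapAtom π) s) ≡ map₁ (swapAtom π) (map₂ there s)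
  step (inj₁ _) = refl
  step (inj₂ _) = refl

mutual
  swapP-ren : ∀ {Γ Δ} π (ρ : Ren Γ Δ) (X : Pred Γ) → swapP π (renP ρ X) ≡ renP (swapR π ρ) (swapP π X)
  swapP-ren π ρ (and Xs) = cong and (swapL-ren π ρ Xs)
  swapP-ren π ρ (neg X) = cong neg (swapP-ren π ρ X)
  swapP-ren π ρ (all l X) =
    cong (all l) (trans (swapP-ren π (lift ρ) X) (renP-cong (λ v → sym (lift-swapR π ρ v)) (swapP π X)))
  swapP-ren π ρ (elt y c) = cong (λ t → elt t (swapAtom π c)) (swapT-ren π ρ y)
  swapP-ren π ρ (eltB y v) =
    trans (cong (swapP π) (renP-eltB ρ y v)) (trans (cases (ρ v)) (sym (renP-eltB (swapR π ρ) (swapT π y) v)))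
    where
    cases : ∀ s → swapP π (eltOr (renT ρ y) s) ≡ eltOr (renT (swapR π ρ) (swapT π y)) (map₁ (swapAtom π) s)
    cases (inj₁ c) = cong (λ t → elt t (swapAtom π c)) (swapT-ren π ρ y)
    cases (inj₂ w) = cong (λ t → eltB t w) (swapT-ren π ρ y)

  swapL-ren : ∀ {Γ Δ} π (ρ : Ren Γ Δ) (Xs : List (Pred Γ)) → swapL π (renL ρ Xs) ≡ renL (swapR π ρ) (swapL π Xs)
  swapL-ren π ρ [] = refl
  swapL-ren π ρ (X ∷ Xs) = cong₂ _∷_ (swapP-ren π ρ X) (swapL-ren π ρ Xs)

  swapT-ren : ∀ {Γ Δ k} π (ρ : Ren Γ Δ) (x : SetT Γ k) → swapT π (renT ρ x) ≡ renT (swapR π ρ) (swapT π x)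
  swapT-ren π ρ (atm c) = refl
  swapT-ren π ρ (atmB v) =
    trans (cong (swapT π) (renT-atmB ρ v)) (trans (cases (ρ v)) (sym (renT-atmB (swapR π ρ) v)))
    where
    cases : ∀ s → swapT π (atmOr s) ≡ atmOr (map₁ (swapAtom π) s)
    cases (inj₁ c) = refl
    cases (inj₂ w) = refl
  swapT-ren π ρ (st X) =
    cong st (trans (swapP-ren π (lift ρ) X) (renP-cong (λ v → sym (lift-swapR π ρ v)) (swapP π X)))

swapT-wk : ∀ {Γ k l} π (x : SetT Γ k) → swapT π (wk {l = l} x) ≡ wk (swapT π x)
swapT-wk π x = swapT-ren π wkR x

swapP-open : ∀ {Γ k} π (a' : Atom k) (X : Pred (k ∷ Γ)) → swapP π (openP a' X) ≡ openP (swapAtom π a') (swapP π X)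
swapP-open π a' X = trans (swapP-ren π (openR a') X) (renP-cong swap-openR (swapP π X))
  where
  swap-openR : swapR π (openR a') ≗R openR (swapAtom π a')
  swap-openR (here refl) = refl
  swap-openR (there v) = refl

-- The graph of the sigma-action

FreshFor : ∀ {Γ i} → Atom (ℤ.pred i) → Pred (ℤ.pred i ∷ Γ) → SetT Γ (ℤ.pred i) → Set
FreshFor {i = i} a' X y = name a' ∉ atomsP (ℤ.pred i) X ++ atomsT (ℤ.pred i) y

-- SubP a x Z R : R is Z[a ↦ x];  Mem y x R : R is the predicate "y ∈ x",
-- i.e. elt(y,a)[a ↦ x] once y has been substituted.  The st-clause of Mem
-- asks for X[a' ↦ y] at every fresh a'; Mem-st below shows one suffices.
mutual
  data SubP {Γ i} (a : Atom i) (x : SetT Γ i) : Pred Γ → Pred Γ → Set where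
    s-and : ∀ {Xs Rs} → SubL a x Xs Rs → SubP a x (and Xs) (and Rs)
    s-neg : ∀ {X R} → SubP a x X R → SubP a x (neg X) (neg R)
    s-all : ∀ {l X R} → SubP a (wk x) X R → SubP a x (all l X) (all l R)
    s-eltB : ∀ {k} {y y' : SetT Γ (ℤ.pred k)} {v : k ∈ Γ} → SubT a x y y' → SubP a x (eltB y v) (eltB y' v)
    s-elt : ∀ {k} {y y' : SetT Γ (ℤ.pred k)} {c : Atom k} → Distinct c a → SubT a x y y' → SubP a x (elt y c) (elt y' c)
    s-hit : ∀ {y y' R} → SubT a x y y' → Mem y' x R → SubP a x (elt y a) R

  data SubL {Γ i} (a : Atom i) (x : SetT Γ i) : List (Pred Γ) → List (Pred Γ) → Set where
    s-[] : SubL a x [] []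
    s-∷ : ∀ {X R Xs Rs} → SubP a x X R → SubL a x Xs Rs → SubL a x (X ∷ Xs) (R ∷ Rs)

  data SubT {Γ i} (a : Atom i) (x : SetT Γ i) : ∀ {k} → SetT Γ k → SetT Γ k → Set where
    t-atm : ∀ {k} {c : Atom k} → Distinct c a → SubT a x (atm c) (atm c)
    t-hit : SubT a x (atm a) x
    t-atmB : ∀ {k} {v : k ∈ Γ} → SubT a x (atmB v) (atmB v)
    t-st : ∀ {k} {X : Pred (ℤ.pred k ∷ Γ)} {R} → SubP a (wk x) X R → SubT a x (st {i = k} X) (st R)

  data Mem {Γ i} : SetT Γ (ℤ.pred i) → SetT Γ i → Pred Γ → Set where
    m-atm : ∀ {y} {c : Atom i} → Mem y (atm c) (elt y c)
    m-atmB : ∀ {y} {u : i ∈ Γ} → Mem y (atmB u) (eltB y u)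
    m-st : ∀ {y X R} → (∀ (a' : Atom (ℤ.pred i)) → FreshFor {i = i} a' X y → SubP a' y (openP a' X) R) → Mem y (st X) R

-- the canonical such atom, as chosen in Defs by 'hit'
stAtom : ∀ {Γ i} → Pred (ℤ.pred i ∷ Γ) → SetT Γ (ℤ.pred i) → Atom (ℤ.pred i)
stAtom {i = i} X y = freshAtom (atomsP (ℤ.pred i) X ++ atomsT (ℤ.pred i) y)

stAtom-fresh : ∀ {Γ i} (X : Pred (ℤ.pred i ∷ Γ)) (y : SetT Γ (ℤ.pred i)) → FreshFor {i = i} (stAtom {i = i} X y) X y
stAtom-fresh X y = freshName∉ _

castSubP : ∀ {Γ i} {a a' : Atom i} {x x' : SetT Γ i} {Z Z' R R'} →
  a ≡ a' → x ≡ x' → Z ≡ Z' → R ≡ R' → SubP a x Z R → SubP a' x' Z' R'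
castSubP refl refl refl refl d = d

mutual
  swap-SubP : ∀ {Γ i} π {a : Atom i} {x : SetT Γ i} {Z R} → SubP a x Z R →
              SubP (swapAtom π a) (swapT π x) (swapP π Z) (swapP π R)
  swap-SubP π (s-and d) = s-and (swap-SubL π d)
  swap-SubP π (s-neg d) = s-neg (swap-SubP π d)
  swap-SubP π {x = x} (s-all d) = s-all (castSubP refl (swapT-wk π x) refl refl (swap-SubP π d))
  swap-SubP π (s-eltB d) = s-eltB (swap-SubT π d)
  swap-SubP π (s-elt c≢a d) = s-elt (swapAtom-Distinct π c≢a) (swap-SubT π d)
  swap-SubP π (s-hit d m) = s-hit (swap-SubT π d) (swap-Mem π m)

  swap-SubL : ∀ {Γ i} π {a : Atom i} {x : SetT Γ i} {Zs Rs} → SubL a x Zs Rs →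
              SubL (swapAtom π a) (swapT π x) (swapL π Zs) (swapL π Rs)
  swap-SubL π s-[] = s-[]
  swap-SubL π (s-∷ d ds) = s-∷ (swap-SubP π d) (swap-SubL π ds)

  swap-SubT : ∀ {Γ i k} π {a : Atom i} {x : SetT Γ i} {z r : SetT Γ k} → SubT a x z r →
              SubT (swapAtom π a) (swapT π x) (swapT π z) (swapT π r)
  swap-SubT π (t-atm c≢a) = t-atm (swapAtom-Distinct π c≢a)
  swap-SubT π t-hit = t-hit
  swap-SubT π t-atmB = t-atmB
  swap-SubT π {x = x} (t-st d) = t-st (castSubP refl (swapT-wk π x) refl refl (swap-SubP π d))

  -- instantiate at a'' = π a'; a' is fresh for X, y because a'' is for π X, π y
  swap-Mem : ∀ {Γ i} π {y : SetT Γ (ℤ.pred i)} {x : SetT Γ i} {R} → Mem y x R → Mem (swapT π y) (swapT π x) (swapP π R)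
  swap-Mem π m-atm = m-atm
  swap-Mem π m-atmB = m-atmB
  swap-Mem {i = i} π {y} (m-st {X = X} f) = m-st λ a'' a''-fresh →
    let a' = swapAtom π a''
        a'-fresh : FreshFor {i = i} a' X y
        a'-fresh = ∉-++⁺ (swap-∉P π (ℤ.pred i) (name a'') X (∉-++⁻ˡ _ a''-fresh))
                         (swap-∉T π (ℤ.pred i) (name a'') y (∉-++⁻ʳ (atomsP _ (swapP π X)) a''-fresh))
    in castSubP (swapAtom-invol π a'') refl
         (trans (swapP-open π a' X) (cong (λ b → openP b (swapP π X)) (swapAtom-invol π a''))) refl
         (swap-SubP π (f a' a'-fresh))

OnlyAt : ∀ {i} → Atom i → ℤ → ℕ → List ℕ → Set
OnlyAt {i} a l n xs = n ∈ xs → _≡_ {A = AtomΣ} (l , at n) (i , a)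

open-OnlyAt : ∀ {Γ k l} (a' : Atom k) (X : Pred (k ∷ Γ)) n → n ∉ atomsP l X → OnlyAt a' l n (atomsP l (openP a' X))
open-OnlyAt a' X n n∉X p with ∈open⁻ a' X p
... | inj₁ q = ⊥-elim (n∉X q)
... | inj₂ e = e

mutual
  SubP-support : ∀ {Γ i} {a : Atom i} {x : SetT Γ i} {Z R} l n → SubP a x Z R →
    n ∉ atomsT l x → OnlyAt a l n (atomsP l Z) → n ∉ atomsP l R
  SubP-support l n (s-and d) n∉x only = SubL-support l n d n∉x only
  SubP-support l n (s-neg d) n∉x only = SubP-support l n d n∉x only
  SubP-support {x = x} l n (s-all d) n∉x only = SubP-support l n d (λ p → n∉x (∈wk⁻ x p)) only
  SubP-support l n (s-eltB d) n∉x only = SubT-support l n d n∉x only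
  SubP-support l n (s-elt {y = y} {y'} {c} c≢a d) n∉x only p with ∈elt⁻ y' c p
  ... | inj₁ (refl , refl) = c≢a (only (∈elt-atom y c refl))
  ... | inj₂ q = SubT-support l n d n∉x (λ r → only (∈elt-set y c r)) q
  SubP-support {a = a} l n (s-hit {y = y} d m) n∉x only =
    Mem-support l n m (SubT-support l n d n∉x (λ r → only (∈elt-set y a r))) n∉x

  SubL-support : ∀ {Γ i} {a : Atom i} {x : SetT Γ i} {Zs Rs} l n → SubL a x Zs Rs →
    n ∉ atomsT l x → OnlyAt a l n (atomsL l Zs) → n ∉ atomsL l Rs
  SubL-support l n s-[] n∉x only ()
  SubL-support l n (s-∷ {X = X} {R} d ds) n∉x only p with ∈-++⁻ (atomsP l R) p
  ... | inj₁ q = SubP-support l n d n∉x (λ r → only (∈-++⁺ˡ r)) q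
  ... | inj₂ q = SubL-support l n ds n∉x (λ r → only (∈-++⁺ʳ (atomsP l X) r)) q

  SubT-support : ∀ {Γ i k} {a : Atom i} {x : SetT Γ i} {z r : SetT Γ k} l n → SubT a x z r →
    n ∉ atomsT l x → OnlyAt a l n (atomsT l z) → n ∉ atomsT l r
  SubT-support {Γ} l n (t-atm {c = c} c≢a) n∉x only p with ∈atm⁻ {Γ} {c = c} p
  ... | refl , refl = c≢a (only p)
  SubT-support l n t-hit n∉x only p = n∉x p
  SubT-support l n t-atmB n∉x only ()
  SubT-support {x = x} l n (t-st d) n∉x only = SubP-support l n d (λ p → n∉x (∈wk⁻ x p)) only

  Mem-support : ∀ {Γ i} {y : SetT Γ (ℤ.pred i)} {x : SetT Γ i} {R} l n → Mem y x R →
    n ∉ atomsT l y → n ∉ atomsT l x → n ∉ atomsP l R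
  Mem-support {Γ} l n (m-atm {y = y} {c}) n∉y n∉x p with ∈elt⁻ y c p
  ... | inj₁ (e , refl) = n∉x (∈atm⁺ {Γ} {c = c} e)
  ... | inj₂ q = n∉y q
  Mem-support l n m-atmB n∉y n∉x p = n∉y p
  Mem-support {i = i} {y = y} l n (m-st {X = X} f) n∉y n∉x =
    SubP-support l n (f _ (stAtom-fresh {i = i} X y)) n∉y (open-OnlyAt (stAtom {i = i} X y) X n n∉x)

-- one fresh instance of the st-clause suffices: any other fresh a' is
-- reached by swapping a₀ and a', which fixes X, y and the result R
Mem-st : ∀ {Γ i} {y : SetT Γ (ℤ.pred i)} {X : Pred (ℤ.pred i ∷ Γ)} {R} (a₀ : Atom (ℤ.pred i)) →
  FreshFor {i = i} a₀ X y → SubP a₀ y (openP a₀ X) R → Mem {i = i} y (st X) R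
Mem-st {i = i} {y} {X} {R} a₀ a₀-fresh d = m-st instance-at
  where
  instance-at : ∀ a' → FreshFor {i = i} a' X y → SubP a' y (openP a' X) R
  instance-at a' a'-fresh =
    castSubP (swapAtom-left a₀ a') (swapT-fixed π y y-fixed)
      (trans (swapP-open π a₀ X) (cong₂ openP (swapAtom-left a₀ a') (swapP-fixed π X X-fixed)))
      (swapP-fixed π R R-fixed) (swap-SubP π d)
    where
    π = swap (ℤ.pred i) (name a₀) (name a')
    X-fixed : SwapFresh π (atomsP (ℤ.pred i) X)
    X-fixed = ∉-++⁻ˡ _ a₀-fresh , ∉-++⁻ˡ _ a'-fresh
    y-fixed : SwapFresh π (atomsT (ℤ.pred i) y)
    y-fixed = ∉-++⁻ʳ (atomsP _ X) a₀-fresh , ∉-++⁻ʳ (atomsP _ X) a'-fresh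
    R-avoids : ∀ n → FreshFor {i = i} (at n) X y → n ∉ atomsP (ℤ.pred i) R
    R-avoids n fresh =
      SubP-support (ℤ.pred i) n d (∉-++⁻ʳ (atomsP _ X) fresh) (open-OnlyAt a₀ X n (∉-++⁻ˡ _ fresh))
    R-fixed : SwapFresh π (atomsP (ℤ.pred i) R)
    R-fixed = R-avoids (name a₀) a₀-fresh , R-avoids (name a') a'-fresh

RenAvoids : ∀ {Γ Δ i} → Ren Γ Δ → Atom i → Set
RenAvoids {Γ} ρ a = ∀ {l} (v : l ∈ Γ) (c : Atom l) → ρ v ≡ inj₁ c → Distinct c a

RenBelow : ∀ {Γ Δ} → Ren Γ Δ → ℕ → Set
RenBelow {Γ} ρ B = ∀ {l} (v : l ∈ Γ) (c : Atom l) → ρ v ≡ inj₁ c → name c ℕ.< B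

lift-RenAvoids : ∀ {Γ Δ k i} {ρ : Ren Γ Δ} {a : Atom i} → RenAvoids ρ a → RenAvoids (lift {k = k} ρ) a
lift-RenAvoids {ρ = ρ} avoids v c e with lift-inj₁ ρ v c e
... | u , e' = avoids u c e'

lift-RenBelow : ∀ {Γ Δ k B} {ρ : Ren Γ Δ} → RenBelow ρ B → RenBelow (lift {k = k} ρ) B
lift-RenBelow {ρ = ρ} below v c e with lift-inj₁ ρ v c e
... | u , e' = below u c e'

wkR-RenAvoids : ∀ {Γ l i} {a : Atom i} → RenAvoids (wkR {Γ} {l}) a
wkR-RenAvoids v c ()

wkR-RenBelow : ∀ {Γ l} → RenBelow (wkR {Γ} {l}) 0
wkR-RenBelow v c ()

openR-RenAvoids : ∀ {Γ k i} {a' : Atom k} {b : Atom i} → Distinct a' b → RenAvoids (openR {Γ} a') b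
openR-RenAvoids a'≢b (here refl) c refl = a'≢b
openR-RenAvoids a'≢b (there v) c ()

openR-RenBelow : ∀ {Γ k} {a' : Atom k} → RenBelow (openR {Γ} a') (suc (name a'))
openR-RenBelow (here refl) c refl = ℕP.≤-refl
openR-RenBelow (there v) c ()

-- R = Z[a ↦ x] implies ρR = (ρZ)[a ↦ ρx], provided ρ does not introduce a;
-- the bound B lets us choose the fresh atom of an st-clause outside ρ's range
mutual
  ren-SubP : ∀ {Γ Δ i B} {a : Atom i} {x : SetT Γ i} {Z R} (ρ : Ren Γ Δ) → RenAvoids ρ a → RenBelow ρ B →
             SubP a x Z R → SubP a (renT ρ x) (renP ρ Z) (renP ρ R)
  ren-SubP ρ avoids below (s-and d) = s-and (ren-SubL ρ avoids below d)
  ren-SubP ρ avoids below (s-neg d) = s-neg (ren-SubP ρ avoids below d)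
  ren-SubP {x = x} ρ avoids below (s-all d) =
    s-all (castSubP refl (lift-wk ρ x) refl refl (ren-SubP (lift ρ) (lift-RenAvoids avoids) (lift-RenBelow below) d))
  ren-SubP {a = a} {x} ρ avoids below (s-eltB {y = y} {y'} {v} d) =
    castSubP refl refl (sym (renP-eltB ρ y v)) (sym (renP-eltB ρ y' v)) (cases (ρ v) refl)
    where
    cases : ∀ s → ρ v ≡ s → SubP a (renT ρ x) (eltOr (renT ρ y) s) (eltOr (renT ρ y') s)
    cases (inj₁ c) e = s-elt (avoids v c e) (ren-SubT ρ avoids below d)
    cases (inj₂ w) e = s-eltB (ren-SubT ρ avoids below d)
  ren-SubP ρ avoids below (s-elt c≢a d) = s-elt c≢a (ren-SubT ρ avoids below d)
  ren-SubP ρ avoids below (s-hit d m) = s-hit (ren-SubT ρ avoids below d) (ren-Mem ρ below m)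

  ren-SubL : ∀ {Γ Δ i B} {a : Atom i} {x : SetT Γ i} {Zs Rs} (ρ : Ren Γ Δ) → RenAvoids ρ a → RenBelow ρ B →
             SubL a x Zs Rs → SubL a (renT ρ x) (renL ρ Zs) (renL ρ Rs)
  ren-SubL ρ avoids below s-[] = s-[]
  ren-SubL ρ avoids below (s-∷ d ds) = s-∷ (ren-SubP ρ avoids below d) (ren-SubL ρ avoids below ds)

  ren-SubT : ∀ {Γ Δ i k B} {a : Atom i} {x : SetT Γ i} {z r : SetT Γ k} (ρ : Ren Γ Δ) → RenAvoids ρ a → RenBelow ρ B →
             SubT a x z r → SubT a (renT ρ x) (renT ρ z) (renT ρ r)
  ren-SubT ρ avoids below (t-atm c≢a) = t-atm c≢a
  ren-SubT ρ avoids below t-hit = t-hit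
  ren-SubT {a = a} {x} ρ avoids below (t-atmB {v = v}) =
    subst₂ (SubT a (renT ρ x)) (sym (renT-atmB ρ v)) (sym (renT-atmB ρ v)) (cases (ρ v) refl)
    where
    cases : ∀ s → ρ v ≡ s → SubT a (renT ρ x) (atmOr s) (atmOr s)
    cases (inj₁ c) e = t-atm (avoids v c e)
    cases (inj₂ w) e = t-atmB
  ren-SubT {x = x} ρ avoids below (t-st d) =
    t-st (castSubP refl (lift-wk ρ x) refl refl (ren-SubP (lift ρ) (lift-RenAvoids avoids) (lift-RenBelow below) d))

  ren-Mem : ∀ {Γ Δ i B} {y : SetT Γ (ℤ.pred i)} {x : SetT Γ i} {R} (ρ : Ren Γ Δ) → RenBelow ρ B →
            Mem y x R → Mem (renT ρ y) (renT ρ x) (renP ρ R)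
  ren-Mem ρ below m-atm = m-atm
  ren-Mem {i = i} {y = y} ρ below (m-atmB {u = u}) =
    subst₂ (Mem (renT ρ y)) (sym (renT-atmB ρ u)) (sym (renP-eltB ρ y u)) (cases (ρ u))
    where
    cases : ∀ s → Mem (renT ρ y) (atmOr s) (eltOr (renT ρ y) s)
    cases (inj₁ c) = m-atm
    cases (inj₂ w) = m-atmB
  ren-Mem {i = i} {B} {y = y} ρ below (m-st {X = X} f) =
    Mem-st a₀ fresh-after (castSubP refl refl (open-lift ρ a₀ X) refl (ren-SubP ρ avoids below (f a₀ fresh-before)))
    where
    before = atomsP (ℤ.pred i) X ++ atomsT (ℤ.pred i) y
    after = atomsP (ℤ.pred i) (renP (lift ρ) X) ++ atomsT (ℤ.pred i) (renT ρ y)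
    used = before ++ after ++ B ∷ []
    a₀ : Atom (ℤ.pred i)
    a₀ = freshAtom used
    fresh-before : FreshFor {i = i} a₀ X y
    fresh-before = ∉-++⁻ˡ before (freshName∉ used)
    fresh-after : FreshFor {i = i} a₀ (renP (lift ρ) X) (renT ρ y)
    fresh-after = ∉-++⁻ˡ after (∉-++⁻ʳ before (freshName∉ used))
    B≤ : B ℕ.≤ maxℕ used
    B≤ = max-upper used (∈-++⁺ʳ before (∈-++⁺ʳ after (here refl)))
    avoids : RenAvoids ρ a₀
    avoids u c e = name≢⇒Distinct (λ q → ℕP.<-irrefl q (ℕP.<-trans (below u c e) (ℕ.s≤s B≤)))

wk-levels : ∀ {Γ k l L} (x : SetT Γ k) → stT x ⊆ L → stT (wk {l = l} x) ⊆ L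
wk-levels x x⊆ p = x⊆ (subst (_ ∈_) (stT-ren wkR x) p)

open-levels : ∀ {Γ k L} (a' : Atom k) (X : Pred (k ∷ Γ)) → stP X ⊆ L → stP (openP a' X) ⊆ L
open-levels a' X X⊆ p = X⊆ (subst (_ ∈_) (stP-ren (openR a') X) p)

mutual
  SubP-levels : ∀ {Γ i} {a : Atom i} {x : SetT Γ i} {Z R L} → SubP a x Z R → stP Z ⊆ L → stT x ⊆ L → stP R ⊆ L
  SubP-levels (s-and d) Z⊆ x⊆ = SubL-levels d Z⊆ x⊆
  SubP-levels (s-neg d) Z⊆ x⊆ = SubP-levels d Z⊆ x⊆
  SubP-levels {x = x} (s-all d) Z⊆ x⊆ = SubP-levels d Z⊆ (wk-levels x x⊆)
  SubP-levels (s-eltB d) Z⊆ x⊆ = SubT-levels d Z⊆ x⊆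
  SubP-levels (s-elt c≢a d) Z⊆ x⊆ = SubT-levels d Z⊆ x⊆
  SubP-levels (s-hit d m) Z⊆ x⊆ = Mem-levels m (SubT-levels d Z⊆ x⊆) x⊆

  SubL-levels : ∀ {Γ i} {a : Atom i} {x : SetT Γ i} {Zs Rs L} → SubL a x Zs Rs → stL Zs ⊆ L → stT x ⊆ L → stL Rs ⊆ L
  SubL-levels s-[] Z⊆ x⊆ ()
  SubL-levels (s-∷ {X = X} {R} d ds) Z⊆ x⊆ p with ∈-++⁻ (stP R) p
  ... | inj₁ q = SubP-levels d (λ r → Z⊆ (∈-++⁺ˡ r)) x⊆ q
  ... | inj₂ q = SubL-levels ds (λ r → Z⊆ (∈-++⁺ʳ (stP X) r)) x⊆ q

  SubT-levels : ∀ {Γ i k} {a : Atom i} {x : SetT Γ i} {z r : SetT Γ k} {L} → SubT a x z r → stT z ⊆ L → stT x ⊆ L → stT r ⊆ L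
  SubT-levels (t-atm c≢a) z⊆ x⊆ ()
  SubT-levels t-hit z⊆ x⊆ = x⊆
  SubT-levels t-atmB z⊆ x⊆ ()
  SubT-levels (t-st d) z⊆ x⊆ (here e) = z⊆ (here e)
  SubT-levels {x = x} (t-st d) z⊆ x⊆ (there p) = SubP-levels d (λ q → z⊆ (there q)) (wk-levels x x⊆) p

  Mem-levels : ∀ {Γ i} {y : SetT Γ (ℤ.pred i)} {x : SetT Γ i} {R L} → Mem y x R → stT y ⊆ L → stT x ⊆ L → stP R ⊆ L
  Mem-levels m-atm y⊆ x⊆ = y⊆
  Mem-levels m-atmB y⊆ x⊆ = y⊆
  Mem-levels {i = i} {y = y} (m-st {X = X} f) y⊆ x⊆ =
    SubP-levels (f _ (stAtom-fresh {i = i} X y)) (open-levels (stAtom {i = i} X y) X (λ p → x⊆ (there p))) y⊆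

mutual
  SubP-fresh : ∀ {Γ i} (a : Atom i) (x : SetT Γ i) (Z : Pred Γ) → name a ∉ atomsP i Z → SubP a x Z Z
  SubP-fresh a x (and Xs) a∉ = s-and (SubL-fresh a x Xs a∉)
  SubP-fresh a x (neg X) a∉ = s-neg (SubP-fresh a x X a∉)
  SubP-fresh a x (all l X) a∉ = s-all (SubP-fresh a (wk x) X a∉)
  SubP-fresh {i = i} a x (elt {k} y c) a∉ with (k , c) ≟Σ (i , a)
  ... | yes refl = ⊥-elim (a∉ (∈elt-atom y a refl))
  ... | no c≢a = s-elt c≢a (SubT-fresh a x y (λ p → a∉ (∈elt-set y c p)))
  SubP-fresh a x (eltB y v) a∉ = s-eltB (SubT-fresh a x y a∉)

  SubL-fresh : ∀ {Γ i} (a : Atom i) (x : SetT Γ i) (Xs : List (Pred Γ)) → name a ∉ atomsL i Xs → SubL a x Xs Xs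
  SubL-fresh a x [] a∉ = s-[]
  SubL-fresh a x (X ∷ Xs) a∉ = s-∷ (SubP-fresh a x X (∉-++⁻ˡ (atomsP _ X) a∉)) (SubL-fresh a x Xs (∉-++⁻ʳ (atomsP _ X) a∉))

  SubT-fresh : ∀ {Γ i k} (a : Atom i) (x : SetT Γ i) (z : SetT Γ k) → a # z → SubT a x z z
  SubT-fresh {Γ} {i = i} a x (atm {k} c) a∉ with (k , c) ≟Σ (i , a)
  ... | yes refl = ⊥-elim (a∉ (∈atm⁺ {Γ} {c = a} refl))
  ... | no c≢a = t-atm c≢a
  SubT-fresh a x (atmB v) a∉ = t-atmB
  SubT-fresh a x (st X) a∉ = t-st (SubP-fresh a (wk x) X a∉)

mutual
  SubP-det : ∀ {Γ i} {a : Atom i} {x : SetT Γ i} {Z R₁ R₂} → SubP a x Z R₁ → SubP a x Z R₂ → R₁ ≡ R₂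
  SubP-det (s-and d) (s-and e) = cong and (SubL-det d e)
  SubP-det (s-neg d) (s-neg e) = cong neg (SubP-det d e)
  SubP-det (s-all d) (s-all e) = cong (all _) (SubP-det d e)
  SubP-det (s-eltB d) (s-eltB e) = cong (λ t → eltB t _) (SubT-det d e)
  SubP-det (s-elt _ d) (s-elt _ e) = cong (λ t → elt t _) (SubT-det d e)
  SubP-det (s-elt a≢a _) (s-hit _ _) = ⊥-elim (a≢a refl)
  SubP-det (s-hit _ _) (s-elt a≢a _) = ⊥-elim (a≢a refl)
  SubP-det (s-hit d m) (s-hit e n) with SubT-det d e
  ... | refl = Mem-det m n

  SubL-det : ∀ {Γ i} {a : Atom i} {x : SetT Γ i} {Zs R₁ R₂} → SubL a x Zs R₁ → SubL a x Zs R₂ → R₁ ≡ R₂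
  SubL-det s-[] s-[] = refl
  SubL-det (s-∷ d ds) (s-∷ e es) = cong₂ _∷_ (SubP-det d e) (SubL-det ds es)

  SubT-det : ∀ {Γ i k} {a : Atom i} {x : SetT Γ i} {z r₁ r₂ : SetT Γ k} → SubT a x z r₁ → SubT a x z r₂ → r₁ ≡ r₂
  SubT-det (t-atm _) (t-atm _) = refl
  SubT-det (t-atm a≢a) t-hit = ⊥-elim (a≢a refl)
  SubT-det t-hit (t-atm a≢a) = ⊥-elim (a≢a refl)
  SubT-det t-hit t-hit = refl
  SubT-det t-atmB t-atmB = refl
  SubT-det (t-st d) (t-st e) = cong st (SubP-det d e)

  Mem-det : ∀ {Γ i} {y : SetT Γ (ℤ.pred i)} {x : SetT Γ i} {R₁ R₂} → Mem y x R₁ → Mem y x R₂ → R₁ ≡ R₂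
  Mem-det m-atm m-atm = refl
  Mem-det m-atmB m-atmB = refl
  Mem-det {i = i} {y = y} (m-st {X = X} f) (m-st g) = SubP-det (f _ (stAtom-fresh {i = i} X y)) (g _ (stAtom-fresh {i = i} X y))

-- The fuel-based operations of Defs compute the graph

-- Enough n i L: fuel n outlasts every descent i > pred i > ... through
-- levels of L, which is how deep the st-clause can unfold below level i
Enough : ℕ → ℤ → List ℤ → Set
Enough zero i L = ⊥
Enough (suc n) i L = ℤ.pred i ∈ L → Enough n (ℤ.pred i) L

mutual
  sP-graph : ∀ n {Γ i} (a : Atom i) (x : SetT Γ i) (Z : Pred Γ) L → Enough n i L →
    stP Z ⊆ L → stT x ⊆ L → SubP a x Z (sP n a x Z)
  sP-graph n a x (and Xs) L enough Z⊆ x⊆ = s-and (sL-graph n a x Xs L enough Z⊆ x⊆)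
  sP-graph n a x (neg X) L enough Z⊆ x⊆ = s-neg (sP-graph n a x X L enough Z⊆ x⊆)
  sP-graph n a x (all l X) L enough Z⊆ x⊆ = s-all (sP-graph n a (wk x) X L enough Z⊆ (wk-levels x x⊆))
  sP-graph n a x (eltB y v) L enough Z⊆ x⊆ = s-eltB (sT-graph n a x y L enough Z⊆ x⊆)
  sP-graph n {i = i} a x (elt {l} y c) L enough Z⊆ x⊆ with l ℤ.≟ i
  ... | no l≢i = s-elt (λ e → l≢i (≡Σ⇒level e)) (sT-graph n a x y L enough Z⊆ x⊆)
  ... | yes refl with name c ℕ.≟ name a
  ...   | no c≢a = s-elt (name≢⇒Distinct c≢a) (sT-graph n a x y L enough Z⊆ x⊆)
  ...   | yes c≡a with name⇒≡ {a = c} {a} c≡a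
  ...     | refl = s-hit y-graph (hit-graph n (sT n a x y) x L enough (SubT-levels y-graph Z⊆ x⊆) x⊆)
    where
    y-graph = sT-graph n a x y L enough Z⊆ x⊆

  sL-graph : ∀ n {Γ i} (a : Atom i) (x : SetT Γ i) (Xs : List (Pred Γ)) L → Enough n i L →
    stL Xs ⊆ L → stT x ⊆ L → SubL a x Xs (sL n a x Xs)
  sL-graph n a x [] L enough Xs⊆ x⊆ = s-[]
  sL-graph n a x (X ∷ Xs) L enough Xs⊆ x⊆ =
    s-∷ (sP-graph n a x X L enough (λ p → Xs⊆ (∈-++⁺ˡ p)) x⊆)
        (sL-graph n a x Xs L enough (λ p → Xs⊆ (∈-++⁺ʳ (stP X) p)) x⊆)

  sT-graph : ∀ n {Γ i k} (a : Atom i) (x : SetT Γ i) (z : SetT Γ k) L → Enough n i L →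
    stT z ⊆ L → stT x ⊆ L → SubT a x z (sT n a x z)
  sT-graph n {i = i} {k} a x (atm c) L enough z⊆ x⊆ with k ℤ.≟ i
  ... | no k≢i = t-atm (λ e → k≢i (≡Σ⇒level e))
  ... | yes refl with name c ℕ.≟ name a
  ...   | no c≢a = t-atm (name≢⇒Distinct c≢a)
  ...   | yes c≡a with name⇒≡ {a = c} {a} c≡a
  ...     | refl = t-hit
  sT-graph n a x (atmB v) L enough z⊆ x⊆ = t-atmB
  sT-graph n a x (st X) L enough z⊆ x⊆ =
    t-st (sP-graph n a (wk x) X L enough (λ p → z⊆ (there p)) (wk-levels x x⊆))

  hit-graph : ∀ n {Γ i} (y : SetT Γ (ℤ.pred i)) (x : SetT Γ i) L → Enough n i L →
    stT y ⊆ L → stT x ⊆ L → Mem y x (hit n y x)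
  hit-graph n y (atm c) L enough y⊆ x⊆ = m-atm
  hit-graph n y (atmB u) L enough y⊆ x⊆ = m-atmB
  hit-graph zero y (st X) L () y⊆ x⊆
  hit-graph (suc n) {i = i} y (st X) L enough y⊆ x⊆ =
    Mem-st a' (stAtom-fresh {i = i} X y)
      (sP-graph n a' y (openP a' X) L (enough (x⊆ (here refl))) (open-levels a' X (λ p → x⊆ (there p))) y⊆)
    where
    a' : Atom (ℤ.pred i)
    a' = stAtom {i = i} X y

distance-pred : ∀ i l → l ℤ.≤ ℤ.pred i → ∣ i - l ∣ ≡ suc ∣ ℤ.pred i - l ∣
distance-pred i l l≤ with ℤ.pred i - l | ℤP.pred-+ i (ℤ.- l) | ℤP.i≤j⇒0≤j-i l≤
... | .(ℤ.+ m) | e | ℤ.+≤+ {n = m} _ =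
  cong ∣_∣ (trans (sym (ℤP.suc-pred (i - l))) (cong ℤ.suc (sym e)))

distance-Enough : ∀ n i L → (∀ {l} → l ∈ L → l ℤ.≤ ℤ.pred i → ∣ i - l ∣ ℕ.≤ n) → Enough (suc n) i L
distance-Enough zero i L bounded p
  with () ← subst (ℕ._≤ 0) (distance-pred i (ℤ.pred i) ℤP.≤-refl) (bounded p ℤP.≤-refl)
distance-Enough (suc n) i L bounded p = distance-Enough n (ℤ.pred i) L bounded′
  where
  bounded′ : ∀ {l} → l ∈ L → l ℤ.≤ ℤ.pred (ℤ.pred i) → ∣ ℤ.pred i - l ∣ ℕ.≤ n
  bounded′ q l≤ = ℕ.s≤s⁻¹ (subst (ℕ._≤ suc n) (distance-pred i _ l≤′) (bounded q l≤′))
    where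
    l≤′ = ℤP.<⇒≤ (ℤP.i≤pred[j]⇒i<j l≤)

∈⇒≤sum : ∀ {n ns} → n ∈ ns → n ℕ.≤ sum ns
∈⇒≤sum {ns = n ∷ ns} (here refl) = ℕP.m≤m+n n (sum ns)
∈⇒≤sum {ns = m ∷ ns} (there p) = ℕP.≤-trans (∈⇒≤sum p) (ℕP.m≤n+m (sum ns) m)

fuel-Enough : ∀ i L → Enough (fuel i L) i L
fuel-Enough i L = distance-Enough _ i L (λ p _ → ∈⇒≤sum (∈-map⁺ (λ l → ∣ i - l ∣) p))

[↦]P-graph : ∀ {Γ i} (Z : Pred Γ) (a : Atom i) (x : SetT Γ i) → SubP a x Z (Z [ a ↦ x ]P)
[↦]P-graph {i = i} Z a x =
  sP-graph _ a x Z (stP Z ++ stT x) (fuel-Enough i _) (xs⊆xs++ys _ _) (xs⊆ys++xs _ (stP Z))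

[↦]T-graph : ∀ {Γ i k} (z : SetT Γ k) (a : Atom i) (x : SetT Γ i) → SubT a x z (z [ a ↦ x ]T)
[↦]T-graph {i = i} z a x =
  sT-graph _ a x z (stT z ++ stT x) (fuel-Enough i _) (xs⊆xs++ys _ _) (xs⊆ys++xs _ (stT z))

-- The substitution lemma

-- Descent L i: i is accessible for the step i ↦ pred i through levels of L;
-- the induction measure for unfolding st-clauses in the substitution lemma
data Descent (L : List ℤ) (i : ℤ) : Set where
  descend : (ℤ.pred i ∈ L → Descent L (ℤ.pred i)) → Descent L i

Enough⇒Descent : ∀ n {i L} → Enough n i L → Descent L i
Enough⇒Descent zero ()
Enough⇒Descent (suc n) enough = descend (λ p → Enough⇒Descent n (enough p))

descent : ∀ i L → Descent L i
descent i L = Enough⇒Descent _ (fuel-Enough i L)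

SubP-elt⁻ : ∀ {Γ i k} {a : Atom i} {x : SetT Γ i} {w : SetT Γ (ℤ.pred k)} {c : Atom k} {R} →
  Distinct c a → SubP a x (elt w c) R → Σ (SetT Γ (ℤ.pred k)) λ w' → SubT a x w w' × R ≡ elt w' c
SubP-elt⁻ c≢a (s-elt _ d) = _ , d , refl
SubP-elt⁻ a≢a (s-hit d m) = ⊥-elim (a≢a refl)

SubP-hit⁻ : ∀ {Γ i} {a : Atom i} {x : SetT Γ i} {w : SetT Γ (ℤ.pred i)} {R} →
  SubP a x (elt w a) R → Σ (SetT Γ (ℤ.pred i)) λ w' → SubT a x w w' × Mem w' x R
SubP-hit⁻ (s-hit d m) = _ , d , m
SubP-hit⁻ (s-elt a≢a d) = ⊥-elim (a≢a refl)

SubT-atm⁻ : ∀ {Γ i k} {a : Atom i} {x : SetT Γ i} {c : Atom k} {r} → Distinct c a → SubT a x (atm c) r → r ≡ atm c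
SubT-atm⁻ c≢a (t-atm _) = refl
SubT-atm⁻ a≢a t-hit = ⊥-elim (a≢a refl)

SubT-hit⁻ : ∀ {Γ i} {a : Atom i} {x : SetT Γ i} {r} → SubT a x (atm a) r → r ≡ x
SubT-hit⁻ t-hit = refl
SubT-hit⁻ (t-atm a≢a) = ⊥-elim (a≢a refl)

-- Naming: R₁ = Z[a ↦ x], R = R₁[b ↦ y], S = Z[b ↦ y], x' = x[b ↦ y],
-- R' = S[a ↦ x'].  The structural cases are congruences; at elt(w,a) and
-- elt(w,b) the claim reduces to the two lemmas on Mem below, which unfold
-- an st-clause and call the lemma again one level lower.
mutual
  commute-SubP : ∀ {Γ i j L} {a : Atom i} {b : Atom j} {x x' : SetT Γ i} {y : SetT Γ j} {Z R₁ R S R'} →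
    Descent L i → Descent L j → stP Z ⊆ L → stT x ⊆ L → stT y ⊆ L → Distinct a b → a # y →
    SubP a x Z R₁ → SubP b y R₁ R → SubP b y Z S → SubT b y x x' → SubP a x' S R' → R ≡ R'
  commute-SubP ↓i ↓j Z⊆ x⊆ y⊆ a≢b a#y (s-and d₁) (s-and d₂) (s-and d₃) dx (s-and d₄) =
    cong and (commute-SubL ↓i ↓j Z⊆ x⊆ y⊆ a≢b a#y d₁ d₂ d₃ dx d₄)
  commute-SubP ↓i ↓j Z⊆ x⊆ y⊆ a≢b a#y (s-neg d₁) (s-neg d₂) (s-neg d₃) dx (s-neg d₄) =
    cong neg (commute-SubP ↓i ↓j Z⊆ x⊆ y⊆ a≢b a#y d₁ d₂ d₃ dx d₄)
  commute-SubP {x = x} {y = y} ↓i ↓j Z⊆ x⊆ y⊆ a≢b a#y (s-all d₁) (s-all d₂) (s-all d₃) dx (s-all d₄) =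
    cong (all _) (commute-SubP ↓i ↓j Z⊆ (wk-levels x x⊆) (wk-levels y y⊆) a≢b (λ p → a#y (∈wk⁻ y p))
                   d₁ d₂ d₃ (ren-SubT wkR wkR-RenAvoids wkR-RenBelow dx) d₄)
  commute-SubP ↓i ↓j Z⊆ x⊆ y⊆ a≢b a#y (s-eltB d₁) (s-eltB d₂) (s-eltB d₃) dx (s-eltB d₄) =
    cong (λ t → eltB t _) (commute-SubT ↓i ↓j Z⊆ x⊆ y⊆ a≢b a#y d₁ d₂ d₃ dx d₄)
  commute-SubP {j = j} {b = b} ↓i ↓j Z⊆ x⊆ y⊆ a≢b a#y (s-elt {k = k} {c = c} c≢a d₁) D₂ D₃ dx D₄
    with (k , c) ≟Σ (j , b)
  ... | no c≢b with SubP-elt⁻ c≢b D₂ | SubP-elt⁻ c≢b D₃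
  ...   | _ , d₂ , refl | _ , d₃ , refl with SubP-elt⁻ c≢a D₄
  ...     | _ , d₄ , refl = cong (λ t → elt t c) (commute-SubT ↓i ↓j Z⊆ x⊆ y⊆ a≢b a#y d₁ d₂ d₃ dx d₄)
  commute-SubP {a = a} {x' = x'} ↓i ↓j Z⊆ x⊆ y⊆ a≢b a#y (s-elt c≢a d₁) D₂ D₃ dx D₄ | yes refl
    with SubP-hit⁻ D₂ | SubP-hit⁻ D₃
  ... | _ , d₂ , m₂ | wb , d₃ , m₃ with [↦]T-graph wb a x'
  ...   | d₄ with commute-SubT ↓i ↓j Z⊆ x⊆ y⊆ a≢b a#y d₁ d₂ d₃ dx d₄
  ...     | refl = commute-Mem-right ↓i ↓j (SubT-levels d₃ Z⊆ y⊆) (SubT-levels dx x⊆ y⊆) y⊆ a#y m₃ D₄ d₄ m₂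
  commute-SubP {b = b} {y = y} ↓i ↓j Z⊆ x⊆ y⊆ a≢b a#y (s-hit {y' = w₁} d₁ m₁) D₂ D₃ dx D₄
    with SubP-elt⁻ a≢b D₃
  ... | _ , d₃ , refl with SubP-hit⁻ D₄
  ...   | _ , d₄ , m₄ with [↦]T-graph w₁ b y
  ...     | d₂ with commute-SubT ↓i ↓j Z⊆ x⊆ y⊆ a≢b a#y d₁ d₂ d₃ dx d₄
  ...       | refl = commute-Mem-left ↓i ↓j (SubT-levels d₁ Z⊆ x⊆) x⊆ y⊆ m₁ D₂ d₂ dx m₄

  commute-SubL : ∀ {Γ i j L} {a : Atom i} {b : Atom j} {x x' : SetT Γ i} {y : SetT Γ j} {Zs R₁ R S R'} →
    Descent L i → Descent L j → stL Zs ⊆ L → stT x ⊆ L → stT y ⊆ L → Distinct a b → a # y →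
    SubL a x Zs R₁ → SubL b y R₁ R → SubL b y Zs S → SubT b y x x' → SubL a x' S R' → R ≡ R'
  commute-SubL ↓i ↓j Zs⊆ x⊆ y⊆ a≢b a#y s-[] s-[] s-[] dx s-[] = refl
  commute-SubL ↓i ↓j Zs⊆ x⊆ y⊆ a≢b a#y (s-∷ {X = X} d₁ ds₁) (s-∷ d₂ ds₂) (s-∷ d₃ ds₃) dx (s-∷ d₄ ds₄) =
    cong₂ _∷_ (commute-SubP ↓i ↓j (λ p → Zs⊆ (∈-++⁺ˡ p)) x⊆ y⊆ a≢b a#y d₁ d₂ d₃ dx d₄)
              (commute-SubL ↓i ↓j (λ p → Zs⊆ (∈-++⁺ʳ (stP X) p)) x⊆ y⊆ a≢b a#y ds₁ ds₂ ds₃ dx ds₄)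

  commute-SubT : ∀ {Γ i j k L} {a : Atom i} {b : Atom j} {x x' : SetT Γ i} {y : SetT Γ j} {z r₁ r s r' : SetT Γ k} →
    Descent L i → Descent L j → stT z ⊆ L → stT x ⊆ L → stT y ⊆ L → Distinct a b → a # y →
    SubT a x z r₁ → SubT b y r₁ r → SubT b y z s → SubT b y x x' → SubT a x' s r' → r ≡ r'
  commute-SubT {j = j} {b = b} ↓i ↓j z⊆ x⊆ y⊆ a≢b a#y (t-atm {k = k} {c = c} c≢a) D₂ D₃ dx D₄
    with (k , c) ≟Σ (j , b)
  ... | no c≢b with SubT-atm⁻ c≢b D₂ | SubT-atm⁻ c≢b D₃
  ...   | refl | refl = sym (SubT-atm⁻ c≢a D₄)
  commute-SubT {a = a} {x' = x'} {y = y} ↓i ↓j z⊆ x⊆ y⊆ a≢b a#y (t-atm c≢a) D₂ D₃ dx D₄ | yes refl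
    with SubT-hit⁻ D₂ | SubT-hit⁻ D₃
  ... | refl | refl = SubT-det (SubT-fresh a x' y a#y) D₄
  commute-SubT ↓i ↓j z⊆ x⊆ y⊆ a≢b a#y t-hit D₂ D₃ dx D₄ with SubT-atm⁻ a≢b D₃
  ... | refl = trans (SubT-det D₂ dx) (sym (SubT-hit⁻ D₄))
  commute-SubT ↓i ↓j z⊆ x⊆ y⊆ a≢b a#y t-atmB t-atmB t-atmB dx t-atmB = refl
  commute-SubT {x = x} {y = y} ↓i ↓j z⊆ x⊆ y⊆ a≢b a#y (t-st d₁) (t-st d₂) (t-st d₃) dx (t-st d₄) =
    cong st (commute-SubP ↓i ↓j (λ p → z⊆ (there p)) (wk-levels x x⊆) (wk-levels y y⊆) a≢b (λ p → a#y (∈wk⁻ y p))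
              d₁ d₂ d₃ (ren-SubT wkR wkR-RenAvoids wkR-RenBelow dx) d₄)

  commute-Mem-left : ∀ {Γ i j L} {b : Atom j} {w wb : SetT Γ (ℤ.pred i)} {x x' : SetT Γ i} {y : SetT Γ j} {R₁ R R'} →
    Descent L i → Descent L j → stT w ⊆ L → stT x ⊆ L → stT y ⊆ L →
    Mem w x R₁ → SubP b y R₁ R → SubT b y w wb → SubT b y x x' → Mem wb x' R' → R ≡ R'
  commute-Mem-left ↓i ↓j w⊆ x⊆ y⊆ m-atm D₂ dw (t-atm c≢b) m-atm with SubP-elt⁻ c≢b D₂
  ... | _ , d₂ , refl = cong (λ t → elt t _) (SubT-det d₂ dw)
  commute-Mem-left ↓i ↓j w⊆ x⊆ y⊆ m-atm D₂ dw t-hit m₄ with SubP-hit⁻ D₂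
  ... | _ , d₂ , m₂ with SubT-det d₂ dw
  ...   | refl = Mem-det m₂ m₄
  commute-Mem-left ↓i ↓j w⊆ x⊆ y⊆ m-atmB (s-eltB d₂) dw t-atmB m-atmB = cong (λ t → eltB t _) (SubT-det d₂ dw)
  commute-Mem-left {i = i} {b = b} {w} {wb} {y = y} (descend ↓i) ↓j w⊆ x⊆ y⊆
    (m-st {X = X} f) D₂ dw (t-st {R = Xb} dX) (m-st g) =
    commute-SubP (↓i (x⊆ (here refl))) ↓j (open-levels a' X (λ p → x⊆ (there p))) w⊆ y⊆
      (name≢⇒Distinct a'≢b) a'#y (f a' fresh-X) D₂ dX-open dw (g a' fresh-Xb)
    where
    names-X = atomsP (ℤ.pred i) X ++ atomsT (ℤ.pred i) w
    names-Xb = atomsP (ℤ.pred i) Xb ++ atomsT (ℤ.pred i) wb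
    used = names-X ++ names-Xb ++ atomsT (ℤ.pred i) y ++ name b ∷ []
    a' : Atom (ℤ.pred i)
    a' = freshAtom used
    a'∉ : name a' ∉ used
    a'∉ = freshName∉ used
    fresh-X : FreshFor {i = i} a' X w
    fresh-X = ∉-++⁻ˡ names-X a'∉
    fresh-Xb : FreshFor {i = i} a' Xb wb
    fresh-Xb = ∉-++⁻ˡ names-Xb (∉-++⁻ʳ names-X a'∉)
    a'#y : a' # y
    a'#y = ∉-++⁻ˡ (atomsT _ y) (∉-++⁻ʳ names-Xb (∉-++⁻ʳ names-X a'∉))
    a'≢b : name a' ≢ name b
    a'≢b e = ∉-++⁻ʳ (atomsT _ y) (∉-++⁻ʳ names-Xb (∉-++⁻ʳ names-X a'∉)) (here e)
    dX-open : SubP b y (openP a' X) (openP a' Xb)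
    dX-open = castSubP refl (open-wk y a') refl refl
                (ren-SubP (openR a') (openR-RenAvoids (name≢⇒Distinct a'≢b)) openR-RenBelow dX)

  commute-Mem-right : ∀ {Γ i j L} {a : Atom i} {v va : SetT Γ (ℤ.pred j)} {x' : SetT Γ i} {y : SetT Γ j} {S R R'} →
    Descent L i → Descent L j → stT v ⊆ L → stT x' ⊆ L → stT y ⊆ L → a # y →
    Mem v y S → SubP a x' S R' → SubT a x' v va → Mem va y R → R ≡ R'
  commute-Mem-right {Γ} ↓i ↓j v⊆ x'⊆ y⊆ a#y m-atm D₄ dv m-atm with SubP-elt⁻ (#atm⇒Distinct {Γ} a#y) D₄
  ... | _ , d₄ , refl = cong (λ t → elt t _) (SubT-det dv d₄)
  commute-Mem-right ↓i ↓j v⊆ x'⊆ y⊆ a#y m-atmB (s-eltB d₄) dv m-atmB = cong (λ t → eltB t _) (SubT-det dv d₄)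
  commute-Mem-right {i = i} {j} {a = a} {v} {va} {x'} ↓i (descend ↓j) v⊆ x'⊆ y⊆ a#y
    (m-st {X = Y} f) D₄ dv (m-st g) =
    sym (commute-SubP (↓j (y⊆ (here refl))) ↓i (open-levels b' Y (λ p → y⊆ (there p))) v⊆ x'⊆
          (name≢⇒Distinct b'≢a) b'#x' (f b' fresh-v) D₄ (SubP-fresh a x' (openP b' Y) a#Y-open) dv (g b' fresh-va))
    where
    names-v = atomsP (ℤ.pred j) Y ++ atomsT (ℤ.pred j) v
    names-va = atomsP (ℤ.pred j) Y ++ atomsT (ℤ.pred j) va
    used = names-v ++ names-va ++ atomsT (ℤ.pred j) x' ++ name a ∷ []
    b' : Atom (ℤ.pred j)
    b' = freshAtom used
    b'∉ : name b' ∉ used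
    b'∉ = freshName∉ used
    fresh-v : FreshFor {i = j} b' Y v
    fresh-v = ∉-++⁻ˡ names-v b'∉
    fresh-va : FreshFor {i = j} b' Y va
    fresh-va = ∉-++⁻ˡ names-va (∉-++⁻ʳ names-v b'∉)
    b'#x' : b' # x'
    b'#x' = ∉-++⁻ˡ (atomsT _ x') (∉-++⁻ʳ names-va (∉-++⁻ʳ names-v b'∉))
    b'≢a : name b' ≢ name a
    b'≢a e = ∉-++⁻ʳ (atomsT _ x') (∉-++⁻ʳ names-va (∉-++⁻ʳ names-v b'∉)) (here e)
    a#Y-open : name a ∉ atomsP i (openP b' Y)
    a#Y-open p with ∈open⁻ b' Y p
    ... | inj₁ q = a#y q
    ... | inj₂ e = b'≢a (sym (≡Σ⇒name e))

substitution-lemmaP : ∀ {Γ i j} (Z : Pred Γ) (a : Atom i) (x : SetT Γ i) (b : Atom j) (y : SetT Γ j) →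
  Distinct a b → a # y → (Z [ a ↦ x ]P) [ b ↦ y ]P ≡ (Z [ b ↦ y ]P) [ a ↦ x [ b ↦ y ]T ]P
substitution-lemmaP {i = i} {j} Z a x b y a≢b a#y =
  commute-SubP (descent i L) (descent j L) (xs⊆xs++ys _ _) (⊆-trans (xs⊆xs++ys _ _) (xs⊆ys++xs _ (stP Z)))
    (⊆-trans (xs⊆ys++xs _ (stT x)) (xs⊆ys++xs _ (stP Z))) a≢b a#y
    ([↦]P-graph Z a x) ([↦]P-graph _ b y) ([↦]P-graph Z b y) ([↦]T-graph x b y) ([↦]P-graph _ a _)
  where
  L = stP Z ++ stT x ++ stT y

substitution-lemmaT : ∀ {Γ i j k} (z : SetT Γ k) (a : Atom i) (x : SetT Γ i) (b : Atom j) (y : SetT Γ j) →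
  Distinct a b → a # y → (z [ a ↦ x ]T) [ b ↦ y ]T ≡ (z [ b ↦ y ]T) [ a ↦ x [ b ↦ y ]T ]T
substitution-lemmaT {i = i} {j} z a x b y a≢b a#y =
  commute-SubT (descent i L) (descent j L) (xs⊆xs++ys _ _) (⊆-trans (xs⊆xs++ys _ _) (xs⊆ys++xs _ (stT z)))
    (⊆-trans (xs⊆ys++xs _ (stT x)) (xs⊆ys++xs _ (stT z))) a≢b a#y
    ([↦]T-graph z a x) ([↦]T-graph _ b y) ([↦]T-graph z b y) ([↦]T-graph x b y) ([↦]T-graph _ a _)
  where
  L = stT z ++ stT x ++ stT y

[↦]T-fresh : ∀ {Γ i k} (z : SetT Γ k) (a : Atom i) (x : SetT Γ i) → a # z → z [ a ↦ x ]T ≡ z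
[↦]T-fresh z a x a#z = SubT-det ([↦]T-graph z a x) (SubT-fresh a x z a#z)

corollary4p15 : (Z : Pred []) (k : ℤ) (z : SetT [] k)
    (i j : ℤ) (a : Atom i) (x : SetT [] i) (b : Atom j) (y : SetT [] j) →
    Distinct a b → a # y → b # x →
    ((Z [ a ↦ x ]P) [ b ↦ y ]P ≡ (Z [ b ↦ y ]P) [ a ↦ x ]P)
    × ((z [ a ↦ x ]T) [ b ↦ y ]T ≡ (z [ b ↦ y ]T) [ a ↦ x ]T)
corollary4p15 Z k z i j a x b y a≢b a#y b#x =
  trans (substitution-lemmaP Z a x b y a≢b a#y) (cong (λ x' → (Z [ b ↦ y ]P) [ a ↦ x' ]P) x[b↦y]≡x) ,
  trans (substitution-lemmaT z a x b y a≢b a#y) (cong (λ x' → (z [ b ↦ y ]T) [ a ↦ x' ]T) x[b↦y]≡x)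
  where
  x[b↦y]≡x : x [ b ↦ y ]T ≡ x
  x[b↦y]≡x = [↦]T-fresh x b y b#x
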